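{- For $n\ge0$, the number of bi-increasing permutations $\pi\in{\cal S}_n$ satisfying ${\sf exc}(\pi)={\sf des}(\pi)$ equals the Motzkin number $M_n$. Moreover, for each $k\ge0$, the number of such permutations with exactly $k$ descents is $\binom{n}{2k}C_k$.
   Context: Permutations $\pi\in{\cal S}_n$ are written as words $\pi_1\cdots\pi_n$. An excedance of $\pi$ is an integer $i\in[n-1]$ with $\pi_i>i$; ${\sf E}(\pi)$ is the set of excedances, ${\sf exc}(\pi)=|{\sf E}(\pi)|$, ${\sf dexc}(\pi)=\sum_{i\in{\sf E}(\pi)}(\pi_i-i)$, and ${\sf inv}(\pi)$ is the number of pairs $i<j$ with $\pi_i>\pi_j$. A permutation is bi-increasing if ${\sf inv}(\pi)={\sf dexc}(\pi)$. A descent is an $i\in[n-1]$ with $\pi_i>\pi_{i+1}$, and ${\sf des}(\pi)$ is the number of descents. The Motzkin numbers are defined by $M_0=1$ and $M_n=M_{n-1}+\sum_{i=0}^{n-2}M_iM_{n-2-i}$ for $n\ge1$; $C_k=\frac{1}{k+1}\binom{2k}{k}$ is the $k$th Catalan number. -}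

module Defs where

open import Data.Nat using (ℕ; zero; suc; _+_; _*_; _∸_; _<ᵇ_; _≡ᵇ_)
open import Data.Nat.DivMod using (_/_)
open import Data.Nat.Combinatorics using (_C_)
open import Data.Nat.ListAction using (sum)
open import Data.Bool using (Bool; true; false; if_then_else_; _∧_; not)
open import Data.Fin using (Fin; toℕ)
open import Data.Fin.Properties using (all?)
open import Data.List using (List; []; _∷_; _++_; [_]; length; map; upTo; filterᵇ; concatMap; allFin)
open import Data.Vec using (Vec; []; _∷_; lookup; toList)

-- We use 0-based positions and values: the word is a vector v : Vec (Fin n) n,
-- position i (0-based) corresponds to i+1, value v[i] to v[i]+1.
-- Differences and comparisons are invariant under this shift.

words : (m n : ℕ) → List (Vec (Fin m) n)
words m zero    = [] ∷ []
words m (suc n) = concatMap (λ a → map (a ∷_) (words m n)) (allFin m)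

count : ∀ {a} {A : Set a} → (A → Bool) → List A → ℕ
count p xs = length (filterᵇ p xs)

distinct : List ℕ → Bool
distinct []       = true
distinct (x ∷ xs) = (count (λ y → x ≡ᵇ y) xs ≡ᵇ 0) ∧ distinct xs

perms : (n : ℕ) → List (Vec (Fin n) n)
perms n = filterᵇ (λ v → distinct (map toℕ (toList v))) (words n n)

word : ∀ {n} → Vec (Fin n) n → List ℕ
word v = map toℕ (toList v)

inv : List ℕ → ℕ
inv []       = 0
inv (x ∷ xs) = count (λ y → y <ᵇ x) xs + inv xs

excFrom : ℕ → List ℕ → ℕ
excFrom i []       = 0
excFrom i (x ∷ xs) = (if i <ᵇ x then 1 else 0) + excFrom (suc i) xs

dexcFrom : ℕ → List ℕ → ℕ
dexcFrom i []       = 0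
dexcFrom i (x ∷ xs) = (if i <ᵇ x then x ∸ i else 0) + dexcFrom (suc i) xs

exc : List ℕ → ℕ
exc = excFrom 0

dexc : List ℕ → ℕ
dexc = dexcFrom 0

des : List ℕ → ℕ
des []           = 0
des (x ∷ [])     = 0
des (x ∷ y ∷ xs) = (if y <ᵇ x then 1 else 0) + des (y ∷ xs)

bi-increasing : List ℕ → Bool
bi-increasing w = inv w ≡ᵇ dexc w

good : List ℕ → Bool
good w = bi-increasing w ∧ (exc w ≡ᵇ des w)

-- ## Motzkin numbers: M_0 = 1, M_n = M_{n-1} + Σ_{i=0}^{n-2} M_i M_{n-2-i}
at : List ℕ → ℕ → ℕ
at []       _       = 0
at (x ∷ xs) zero    = x
at (x ∷ xs) (suc i) = at xs i

motzUpTo : ℕ → List ℕ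
motzUpTo zero    = 1 ∷ []
motzUpTo (suc n) = L ++ [ at L n + sum (map (λ i → at L i * at L (n ∸ 1 ∸ i)) (upTo n)) ]
  where L = motzUpTo n

motzkin : ℕ → ℕ
motzkin n = at (motzUpTo n) n

catalan : ℕ → ℕ
catalan k = ((2 * k) C k) / suc k

-- A permutation is bi-increasing exactly when each letter is a left-to-right maximum or smaller
-- than every later letter: letter by letter, the excedance height π_i − i of a letter is at most
-- the number of smaller letters after it, with equality precisely in that case.  For such π the
-- excedances are the left-to-right maxima followed somewhere by a smaller letter, so exc = des
-- says that each of them is followed immediately by a smaller letter.  Reading π letter by
-- letter, these conditions are checked by an automaton whose count of completions depends only
-- on how many unused letters lie below the current maximum.  Splitting a completion at the first
-- moment no such letter is left turns the resulting recursion into the recursion of the Motzkin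
-- triangle C(n, 2k) Cₖ (a Motzkin path is a flat step followed by a path, or U P D Q), whose
-- rows sum to the Motzkin numbers.

module Submission where

open import Defs
open import Data.Nat
open import Data.Nat.Properties
open import Data.Nat.Combinatorics using (_C_; nCk+nC[k+1]≡[n+1]C[k+1]; k>n⇒nCk≡0; nCk≡nC[n∸k])
open import Data.Nat.DivMod using (m*n/n≡m)
open import Data.Nat.Solver using (module +-*-Solver)
open import Data.Bool using (Bool; true; false; if_then_else_; _∧_; not; T)
open import Data.Bool.Properties using (∧-assoc; ∧-comm; ∧-identityʳ; ∧-zeroʳ; ∧-conicalˡ; ∧-conicalʳ)
open import Data.Fin using (Fin; toℕ) renaming (zero to fzero; suc to fsuc)
open import Data.Vec using (Vec; toList) renaming ([] to []ᵛ; _∷_ to _∷ᵛ_)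
open import Data.Product using (_×_; _,_; proj₁; proj₂)
open import Data.Empty using (⊥-elim)
open import Data.List using (List; []; _∷_; _++_; [_]; length; map; upTo; filterᵇ; concatMap; allFin; tabulate)
open import Data.Bool.ListAction using (all)
open import Data.List.Properties using (upTo-∷ʳ; map-++; length-++; ++-assoc; length-map)
open import Data.Vec.Properties using (length-toList)
open import Data.Nat.ListAction using (sum)
open import Data.Nat.ListAction.Properties using (sum-++)
open import Data.Sum using (_⊎_; inj₁; inj₂)
open import Relation.Binary.PropositionalEquality hiding ([_])
open import Relation.Nullary using (yes; no)
open import Relation.Binary.Definitions using (tri<; tri≈; tri>)
open import Function using (_∘_; case_of_)
open +-*-Solver using (solve; _:+_; _:*_; _:=_)

𝟙 : Bool → ℕ
𝟙 b = if b then 1 else 0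

𝟙≤1 : ∀ b → 𝟙 b ≤ 1
𝟙≤1 true  = ≤-refl
𝟙≤1 false = z≤n

𝟙-∧ : ∀ x y → 𝟙 (x ∧ y) ≡ 𝟙 x * 𝟙 y
𝟙-∧ true  y = sym (+-identityʳ (𝟙 y))
𝟙-∧ false y = refl

<ᵇ-true : ∀ {m n} → m < n → (m <ᵇ n) ≡ true
<ᵇ-true {zero}  {suc n} _         = refl
<ᵇ-true {suc m} {suc n} (s≤s m<n) = <ᵇ-true m<n

<ᵇ-false : ∀ {m n} → n ≤ m → (m <ᵇ n) ≡ false
<ᵇ-false {m}     {zero}  _         = refl
<ᵇ-false {suc m} {suc n} (s≤s n≤m) = <ᵇ-false n≤m

≤ᵇ-true : ∀ {r s} → r ≤ s → (r ≤ᵇ s) ≡ true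
≤ᵇ-true {zero}  _   = refl
≤ᵇ-true {suc r} r<s = <ᵇ-true r<s

≤ᵇ-false : ∀ {r s} → s < r → (r ≤ᵇ s) ≡ false
≤ᵇ-false (s≤s s≤r) = <ᵇ-false s≤r

≤ᵇ-suc : ∀ r s → (r ≤ᵇ suc s) ≡ (r ∸ 1 ≤ᵇ s)
≤ᵇ-suc zero          s = refl
≤ᵇ-suc (suc zero)    s = refl
≤ᵇ-suc (suc (suc r)) s = refl

<ᵇ-suc : ∀ {b a} → b ≢ a → (b <ᵇ suc a) ≡ (b <ᵇ a)
<ᵇ-suc {b} {a} b≢a with <-cmp b a
... | tri< b<a _ _ = trans (<ᵇ-true (m<n⇒m<1+n b<a)) (sym (<ᵇ-true b<a))
... | tri≈ _ b≡a _ = ⊥-elim (b≢a b≡a)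
... | tri> _ _ b>a = trans (<ᵇ-false b>a) (sym (<ᵇ-false (<⇒≤ b>a)))

<ᵇ-sound : ∀ {m n} → (m <ᵇ n) ≡ true → m < n
<ᵇ-sound {m} {n} e = <ᵇ⇒< m n (subst T (sym e) _)

<ᵇ-false-sound : ∀ {m n} → (m <ᵇ n) ≡ false → n ≤ m
<ᵇ-false-sound e = ≮⇒≥ (λ m<n → case trans (sym (<ᵇ-true m<n)) e of λ ())

≡ᵇ-sound : ∀ {m n} → (m ≡ᵇ n) ≡ true → m ≡ n
≡ᵇ-sound {m} {n} e = ≡ᵇ⇒≡ m n (subst T (sym e) _)

≡ᵇ-refl : ∀ m → (m ≡ᵇ m) ≡ true
≡ᵇ-refl zero    = refl
≡ᵇ-refl (suc m) = ≡ᵇ-refl m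

≡ᵇ-false : ∀ {m n} → m ≢ n → (m ≡ᵇ n) ≡ false
≡ᵇ-false {m} {n} m≢n with m ≡ᵇ n in eq
... | true  = ⊥-elim (m≢n (≡ᵇ-sound eq))
... | false = refl

≡ᵇ-sym : ∀ m n → (m ≡ᵇ n) ≡ (n ≡ᵇ m)
≡ᵇ-sym zero    zero    = refl
≡ᵇ-sym zero    (suc n) = refl
≡ᵇ-sym (suc m) zero    = refl
≡ᵇ-sym (suc m) (suc n) = ≡ᵇ-sym m n

∧-true : ∀ {a b} → a ∧ b ≡ true → a ≡ true × b ≡ true
∧-true {a} {b} e = ∧-conicalˡ a b e , ∧-conicalʳ a b e

∧-guard : ∀ x {y z} → (x ≡ true → y ≡ z) → (x ∧ y) ≡ (x ∧ z)
∧-guard true  y≡z = y≡z refl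
∧-guard false _   = refl

∧-swapˡ : ∀ x y z → (x ∧ (y ∧ z)) ≡ (y ∧ (x ∧ z))
∧-swapˡ x y z = trans (sym (∧-assoc x y z)) (trans (cong (_∧ z) (∧-comm x y)) (∧-assoc y x z))

∑ : ℕ → (ℕ → ℕ) → ℕ
∑ zero    f = 0
∑ (suc n) f = ∑ n f + f n

∑-cong< : ∀ n {f g : ℕ → ℕ} → (∀ i → i < n → f i ≡ g i) → ∑ n f ≡ ∑ n g
∑-cong< zero    eq = refl
∑-cong< (suc n) eq = cong₂ _+_ (∑-cong< n (λ i i<n → eq i (m<n⇒m<1+n i<n))) (eq n (n<1+n n))

∑-cong : ∀ n {f g : ℕ → ℕ} → (∀ i → f i ≡ g i) → ∑ n f ≡ ∑ n g
∑-cong n eq = ∑-cong< n (λ i _ → eq i)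

+-+-swap : ∀ a b c d → a + b + (c + d) ≡ a + c + (b + d)
+-+-swap = solve 4 (λ a b c d → a :+ b :+ (c :+ d) := a :+ c :+ (b :+ d)) refl

∑-+ : ∀ n (f g : ℕ → ℕ) → ∑ n (λ i → f i + g i) ≡ ∑ n f + ∑ n g
∑-+ zero    f g = refl
∑-+ (suc n) f g = begin
  ∑ n (λ i → f i + g i) + (f n + g n) ≡⟨ cong (_+ (f n + g n)) (∑-+ n f g) ⟩
  ∑ n f + ∑ n g + (f n + g n)         ≡⟨ +-+-swap (∑ n f) (∑ n g) (f n) (g n) ⟩
  ∑ n f + f n + (∑ n g + g n)         ∎
  where open ≡-Reasoning

∑-*ˡ : ∀ n c (f : ℕ → ℕ) → ∑ n (λ i → c * f i) ≡ c * ∑ n f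
∑-*ˡ zero    c f = sym (*-zeroʳ c)
∑-*ˡ (suc n) c f = trans (cong (_+ c * f n) (∑-*ˡ n c f)) (sym (*-distribˡ-+ c (∑ n f) (f n)))

∑-*ʳ : ∀ n c (f : ℕ → ℕ) → ∑ n (λ i → f i * c) ≡ ∑ n f * c
∑-*ʳ n c f = trans (∑-cong n (λ i → *-comm (f i) c)) (trans (∑-*ˡ n c f) (*-comm c (∑ n f)))

∑-unfoldˡ : ∀ n (f : ℕ → ℕ) → ∑ (suc n) f ≡ f 0 + ∑ n (λ i → f (suc i))
∑-unfoldˡ zero    f = +-comm 0 (f 0)
∑-unfoldˡ (suc n) f = trans (cong (_+ f (suc n)) (∑-unfoldˡ n f)) (+-assoc (f 0) _ (f (suc n)))

∑-zero : ∀ n {f : ℕ → ℕ} → (∀ i → i < n → f i ≡ 0) → ∑ n f ≡ 0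
∑-zero zero    _  = refl
∑-zero (suc n) f0 = cong₂ _+_ (∑-zero n (λ i i<n → f0 i (m<n⇒m<1+n i<n))) (f0 n (n<1+n n))

∑-comm : ∀ n m (f : ℕ → ℕ → ℕ) → ∑ n (λ i → ∑ m (f i)) ≡ ∑ m (λ j → ∑ n (λ i → f i j))
∑-comm zero    m f = sym (∑-zero m (λ _ _ → refl))
∑-comm (suc n) m f = trans (cong (_+ ∑ m (f n)) (∑-comm n m f)) (sym (∑-+ m _ (f n)))

∑-extend : ∀ n m {f : ℕ → ℕ} → n ≤ m → (∀ i → n ≤ i → f i ≡ 0) → ∑ m f ≡ ∑ n f
∑-extend n m {f} n≤m f0 = subst (λ m → ∑ m f ≡ ∑ n f) (m∸n+n≡m n≤m) (go (m ∸ n))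
  where
  go : ∀ d → ∑ (d + n) f ≡ ∑ n f
  go zero    = refl
  go (suc d) = trans (cong₂ _+_ (go d) (f0 (d + n) (m≤n+m n d))) (+-identityʳ (∑ n f))

∑-single : ∀ n j (f : ℕ → ℕ) → j < n → (∀ i → i < n → i ≢ j → f i ≡ 0) → ∑ n f ≡ f j
∑-single (suc n) j f j<1+n f0 with j ≟ n
... | yes refl = cong (_+ f n) (∑-zero n (λ i i<n → f0 i (m<n⇒m<1+n i<n) (<⇒≢ i<n)))
... | no  j≢n  = trans (cong₂ _+_ (∑-single n j f (≤∧≢⇒< (≤-pred j<1+n) j≢n) (λ i i<n → f0 i (m<n⇒m<1+n i<n)))
                                  (f0 n (n<1+n n) (j≢n ∘ sym)))
                       (+-identityʳ (f j))

+-≤-equality : ∀ {a b c d} → a ≤ c → b ≤ d → a + b ≡ c + d → a ≡ c × b ≡ d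
+-≤-equality {a} {b} {c} {d} a≤c b≤d e = a≡c , +-cancelˡ-≡ a b d (trans e (cong (_+ d) (sym a≡c)))
  where
  a≡c : a ≡ c
  a≡c = ≤-antisym a≤c (+-cancelʳ-≤ d c a (≤-trans (≤-reflexive (sym e)) (+-monoʳ-≤ a b≤d)))

∑-pointwise-≡ : ∀ n (f g : ℕ → ℕ) → (∀ v → v < n → f v ≤ g v) → ∑ n f ≡ ∑ n g → ∀ v → v < n → f v ≡ g v
∑-pointwise-≡ (suc n) f g f≤g e v v<1+n with +-≤-equality (∑-mono n (λ v v<n → f≤g v (m<n⇒m<1+n v<n))) (f≤g n (n<1+n n)) e
  where
  ∑-mono : ∀ m → (∀ v → v < m → f v ≤ g v) → ∑ m f ≤ ∑ m g
  ∑-mono zero    _   = z≤n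
  ∑-mono (suc m) f≤g = +-mono-≤ (∑-mono m (λ v v<m → f≤g v (m<n⇒m<1+n v<m))) (f≤g m (n<1+n m))
... | ∑f≡∑g , fn≡gn with m≤n⇒m<n∨m≡n (≤-pred v<1+n)
...   | inj₁ v<n  = ∑-pointwise-≡ n f g (λ v v<n → f≤g v (m<n⇒m<1+n v<n)) ∑f≡∑g v v<n
...   | inj₂ refl = fn≡gn

sum-map-upTo : ∀ n (f : ℕ → ℕ) → sum (map f (upTo n)) ≡ ∑ n f
sum-map-upTo zero    f = refl
sum-map-upTo (suc n) f = begin
  sum (map f (upTo (suc n)))      ≡⟨ cong (λ xs → sum (map f xs)) (sym (upTo-∷ʳ n)) ⟩
  sum (map f (upTo n ++ [ n ]))   ≡⟨ cong sum (map-++ f (upTo n) [ n ]) ⟩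
  sum (map f (upTo n) ++ [ f n ]) ≡⟨ sum-++ (map f (upTo n)) [ f n ] ⟩
  sum (map f (upTo n)) + (f n + 0) ≡⟨ cong₂ _+_ (sum-map-upTo n f) (+-identityʳ (f n)) ⟩
  ∑ n f + f n                     ∎
  where open ≡-Reasoning

-- Pascal's rule as the definition, so that it holds by computation.
binom : ℕ → ℕ → ℕ
binom n       zero    = 1
binom zero    (suc k) = 0
binom (suc n) (suc k) = binom n k + binom n (suc k)

binom≡C : ∀ n k → binom n k ≡ n C k
binom≡C n       zero    = refl
binom≡C zero    (suc k) = sym (k>n⇒nCk≡0 {0} {suc k} z<s)
binom≡C (suc n) (suc k) =
  trans (cong₂ _+_ (binom≡C n k) (binom≡C n (suc k))) (nCk+nC[k+1]≡[n+1]C[k+1] n k)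

binom-vanishes : ∀ {n k} → n < k → binom n k ≡ 0
binom-vanishes {zero}  {suc k} _         = refl
binom-vanishes {suc n} {suc k} (s≤s n<k) =
  cong₂ _+_ (binom-vanishes n<k) (binom-vanishes (m<n⇒m<1+n n<k))

binom-sym : ∀ {n k} → k ≤ n → binom n k ≡ binom n (n ∸ k)
binom-sym {n} {k} k≤n =
  trans (binom≡C n k) (trans (nCk≡nC[n∸k] k≤n) (sym (binom≡C n (n ∸ k))))

binom-1 : ∀ n → binom n 1 ≡ n
binom-1 zero    = refl
binom-1 (suc n) = cong suc (binom-1 n)

binom-absorb : ∀ n k → suc k * binom (suc n) (suc k) ≡ suc n * binom n k
binom-absorb zero    zero    = refl
binom-absorb zero    (suc k) = *-zeroʳ (suc (suc k))
binom-absorb (suc n) zero    =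
  trans (+-identityʳ _) (trans (binom-1 (suc (suc n))) (sym (*-identityʳ (suc (suc n)))))
binom-absorb (suc n) (suc k) = begin
  suc (suc k) * (B k + B (suc k))
    ≡⟨ *-distribˡ-+ (suc (suc k)) (B k) (B (suc k)) ⟩
  B k + suc k * B k + suc (suc k) * B (suc k)
    ≡⟨ cong₂ (λ x y → B k + x + y) (binom-absorb n k) (binom-absorb n (suc k)) ⟩
  B k + suc n * binom n k + suc n * binom n (suc k)
    ≡⟨ +-assoc (B k) _ _ ⟩
  B k + (suc n * binom n k + suc n * binom n (suc k))
    ≡⟨ cong (B k +_) (sym (*-distribˡ-+ (suc n) (binom n k) (binom n (suc k)))) ⟩
  suc (suc n) * B k ∎
  where
  open ≡-Reasoning
  B : ℕ → ℕ
  B j = binom (suc n) (suc j)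

hockey-stick : ∀ n k → ∑ (suc n) (λ i → binom i k) ≡ binom (suc n) (suc k)
hockey-stick zero    zero    = refl
hockey-stick zero    (suc k) = refl
hockey-stick (suc n) k       =
  trans (cong (_+ binom (suc n) k) (hockey-stick n k)) (+-comm (binom (suc n) (suc k)) (binom (suc n) k))

chu-vandermonde : ∀ n a b →
  ∑ (suc n) (λ i → binom i a * binom (n ∸ i) b) ≡ binom (suc n) (suc (a + b))
chu-vandermonde n       a zero    = begin
  ∑ (suc n) (λ i → binom i a * 1) ≡⟨ ∑-cong (suc n) (λ i → *-identityʳ (binom i a)) ⟩
  ∑ (suc n) (λ i → binom i a)     ≡⟨ hockey-stick n a ⟩
  binom (suc n) (suc a)           ≡⟨ cong (λ x → binom (suc n) (suc x)) (sym (+-identityʳ a)) ⟩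
  binom (suc n) (suc (a + 0))     ∎
  where open ≡-Reasoning
chu-vandermonde zero    a (suc b) =
  trans (*-zeroʳ (binom 0 a)) (sym (binom-vanishes (s≤s (subst (1 ≤_) (sym (+-suc a b)) z<s))))
chu-vandermonde (suc n) a (suc b) = begin
  ∑ (suc n) (λ i → binom i a * binom (suc n ∸ i) (suc b)) + binom (suc n) a * binom (n ∸ n) (suc b)
    ≡⟨ cong₂ _+_ (∑-cong< (suc n) pascal) last-vanishes ⟩
  ∑ (suc n) (λ i → binom i a * binom (n ∸ i) b + binom i a * binom (n ∸ i) (suc b)) + 0
    ≡⟨ +-identityʳ _ ⟩
  ∑ (suc n) (λ i → binom i a * binom (n ∸ i) b + binom i a * binom (n ∸ i) (suc b))
    ≡⟨ ∑-+ (suc n) _ _ ⟩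
  ∑ (suc n) (λ i → binom i a * binom (n ∸ i) b) + ∑ (suc n) (λ i → binom i a * binom (n ∸ i) (suc b))
    ≡⟨ cong₂ _+_ (chu-vandermonde n a b) (chu-vandermonde n a (suc b)) ⟩
  binom (suc n) (suc (a + b)) + binom (suc n) (suc (a + suc b))
    ≡⟨ cong (λ x → binom (suc n) (suc (a + b)) + binom (suc n) (suc x)) (+-suc a b) ⟩
  binom (suc (suc n)) (suc (suc (a + b)))
    ≡⟨ cong (λ x → binom (suc (suc n)) (suc x)) (sym (+-suc a b)) ⟩
  binom (suc (suc n)) (suc (a + suc b)) ∎
  where
  open ≡-Reasoning
  last-vanishes : binom (suc n) a * binom (n ∸ n) (suc b) ≡ 0
  last-vanishes = trans (cong (λ x → binom (suc n) a * binom x (suc b)) (n∸n≡0 n)) (*-zeroʳ (binom (suc n) a))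
  pascal : ∀ i → i < suc n →
    binom i a * binom (suc n ∸ i) (suc b) ≡ binom i a * binom (n ∸ i) b + binom i a * binom (n ∸ i) (suc b)
  pascal i (s≤s i≤n) rewrite +-∸-assoc 1 i≤n = *-distribˡ-+ (binom i a) (binom (n ∸ i) b) (binom (n ∸ i) (suc b))

-- Ballot numbers and Catalan numbers

-- ballot p q counts the paths of p up-steps and q down-steps that never go below their start.
ballot : ℕ → ℕ → ℕ
ballot p       zero    = 1
ballot zero    (suc q) = 0
ballot (suc p) (suc q) = if p <ᵇ q then 0 else ballot p (suc q) + ballot (suc p) q

ballot-vanishes : ∀ {p q} → p < q → ballot p q ≡ 0
ballot-vanishes {zero}  {suc q} _         = refl
ballot-vanishes {suc p} {suc q} (s≤s p<q) rewrite <ᵇ-true p<q = refl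

ballot-step : ∀ {p q} → q ≤ p → ballot (suc p) (suc q) ≡ ballot p (suc q) + ballot (suc p) q
ballot-step q≤p rewrite <ᵇ-false q≤p = refl

ballot-1 : ∀ p → ballot p 1 ≡ p
ballot-1 zero    = refl
ballot-1 (suc p) rewrite ballot-step {p} {0} z≤n | ballot-1 p = +-comm p 1

cat : ℕ → ℕ
cat k = ballot k k

-- The reflection principle ballot p (q + 1) = C(p + q + 1, q + 1) − C(p + q + 1, q), without subtraction.
ballot-reflection : ∀ p q → q ≤ p → ballot p (suc q) + binom (p + suc q) q ≡ binom (p + suc q) (suc q)
ballot-reflection p q q≤p with m≤n⇒m<n∨m≡n q≤p
ballot-reflection q q _ | inj₂ refl = begin
  ballot q (suc q) + binom (q + suc q) q ≡⟨ cong (_+ binom (q + suc q) q) (ballot-vanishes (n<1+n q)) ⟩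
  binom (q + suc q) q                    ≡⟨ binom-sym (m≤m+n q (suc q)) ⟩
  binom (q + suc q) (q + suc q ∸ q)      ≡⟨ cong (binom (q + suc q)) (m+n∸m≡n q (suc q)) ⟩
  binom (q + suc q) (suc q)              ∎
  where open ≡-Reasoning
ballot-reflection (suc p) zero    _ | inj₁ _ rewrite ballot-1 (suc p) | binom-1 (suc p + 1) = refl
ballot-reflection (suc p) (suc q) _ | inj₁ (s≤s q<p) = begin
  ballot (suc p) (suc (suc q)) + (binom N q + binom N (suc q))
    ≡⟨ cong (_+ (binom N q + binom N (suc q))) (ballot-step q<p) ⟩
  ballot p (suc (suc q)) + ballot (suc p) (suc q) + (binom N q + binom N (suc q))
    ≡⟨ regroup (ballot p (suc (suc q))) (ballot (suc p) (suc q)) (binom N q) (binom N (suc q)) ⟩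
  (ballot p (suc (suc q)) + binom N (suc q)) + (ballot (suc p) (suc q) + binom N q)
    ≡⟨ cong₂ _+_ (ballot-reflection p (suc q) q<p) shifted ⟩
  binom N (suc (suc q)) + binom N (suc q)
    ≡⟨ +-comm (binom N (suc (suc q))) (binom N (suc q)) ⟩
  binom (suc N) (suc (suc q)) ∎
  where
  open ≡-Reasoning
  N = p + suc (suc q)
  shifted : ballot (suc p) (suc q) + binom N q ≡ binom N (suc q)
  shifted = subst (λ x → ballot (suc p) (suc q) + binom x q ≡ binom x (suc q)) (sym (+-suc p (suc q)))
                  (ballot-reflection (suc p) q (<⇒≤ (m<n⇒m<1+n q<p)))
  regroup : ∀ a b c e → a + b + (c + e) ≡ (a + e) + (b + c)
  regroup = solve 4 (λ a b c e → a :+ b :+ (c :+ e) := (a :+ e) :+ (b :+ c)) refl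

suc*cat≡central-binom : ∀ k → suc k * cat k ≡ binom (k + k) k
suc*cat≡central-binom zero    = refl
suc*cat≡central-binom (suc j) = +-cancelʳ-≡ (suc (suc j) * X) _ _ (begin
  suc (suc j) * D + suc (suc j) * X ≡⟨ sym (*-distribˡ-+ (suc (suc j)) D X) ⟩
  suc (suc j) * (D + X)             ≡⟨ cong (suc (suc j) *_) (ballot-reflection (suc j) j (n≤1+n j)) ⟩
  B + suc j * B                     ≡⟨ cong (B +_) (sym weighted) ⟩
  B + suc (suc j) * X               ∎)
  where
  open ≡-Reasoning
  m = j + suc j
  D = cat (suc j)
  X = binom (suc m) j
  B = binom (suc m) (suc j)
  X-sym : X ≡ binom (suc m) (suc (suc j))
  X-sym = trans (binom-sym (≤-trans (n≤1+n j) (m≤m+n (suc j) (suc j))))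
                (cong (binom (suc m)) (trans (+-∸-assoc 1 (m≤m+n j (suc j))) (cong suc (m+n∸m≡n j (suc j)))))
  weighted : suc (suc j) * X ≡ suc j * B
  weighted = begin
    suc (suc j) * X                        ≡⟨ cong (suc (suc j) *_) X-sym ⟩
    suc (suc j) * binom (suc m) (suc (suc j)) ≡⟨ binom-absorb m (suc j) ⟩
    suc m * binom m (suc j)                ≡⟨ cong (suc m *_) (cong (binom m) (sym (m+n∸m≡n j (suc j)))) ⟩
    suc m * binom m (m ∸ j)                ≡⟨ cong (suc m *_) (sym (binom-sym (m≤m+n j (suc j)))) ⟩
    suc m * binom m j                      ≡⟨ sym (binom-absorb m j) ⟩
    suc j * B                              ∎

catalan≡cat : ∀ k → catalan k ≡ cat k
catalan≡cat k = begin
  ((2 * k) C k) / suc k      ≡⟨ cong (_/ suc k) (sym (binom≡C (2 * k) k)) ⟩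
  binom (k + (k + 0)) k / suc k ≡⟨ cong (λ x → binom (k + x) k / suc k) (+-identityʳ k) ⟩
  binom (k + k) k / suc k    ≡⟨ cong (_/ suc k) (sym (suc*cat≡central-binom k)) ⟩
  suc k * cat k / suc k      ≡⟨ cong (_/ suc k) (*-comm (suc k) (cat k)) ⟩
  cat k * suc k / suc k      ≡⟨ m*n/n≡m (cat k) (suc k) ⟩
  cat k                      ∎
  where open ≡-Reasoning

∸-suc : ∀ {p j} → j < p → p ∸ j ≡ suc (p ∸ suc j)
∸-suc {suc p} {zero}  _         = refl
∸-suc {suc p} {suc j} (s≤s j<p) = ∸-suc j<p

ballot-step-∸ : ∀ {p q j} → j ≤ q → q < p →
  ballot (p ∸ suc j) (suc q ∸ j) + ballot (p ∸ j) (q ∸ j) ≡ ballot (p ∸ j) (suc q ∸ j)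
ballot-step-∸ {p} {q} {j} j≤q q<p = begin
  ballot (p ∸ suc j) (suc q ∸ j) + ballot (p ∸ j) (q ∸ j)
    ≡⟨ cong₂ (λ x y → ballot (p ∸ suc j) x + ballot y (q ∸ j)) (+-∸-assoc 1 j≤q) p∸j ⟩
  ballot (p ∸ suc j) (suc (q ∸ j)) + ballot (suc (p ∸ suc j)) (q ∸ j)
    ≡⟨ sym (ballot-step (∸-monoˡ-≤ (suc j) q<p)) ⟩
  ballot (suc (p ∸ suc j)) (suc (q ∸ j))
    ≡⟨ cong₂ ballot (sym p∸j) (sym (+-∸-assoc 1 j≤q)) ⟩
  ballot (p ∸ j) (suc q ∸ j) ∎
  where
  open ≡-Reasoning
  p∸j : p ∸ j ≡ suc (p ∸ suc j)
  p∸j = ∸-suc (≤-<-trans j≤q q<p)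

-- Decomposition of a ballot path at its last visit to the starting level.
ballot-last-return : ∀ q {p} → q < p → ballot p q ≡ ∑ (suc q) (λ j → cat j * ballot (p ∸ suc j) (q ∸ j))
ballot-last-return zero    {suc p} _         = refl
ballot-last-return (suc q) {suc p} (s≤s q<p) = begin
  ballot (suc p) (suc q)
    ≡⟨ ballot-step (<⇒≤ q<p) ⟩
  ballot p (suc q) + ballot (suc p) q
    ≡⟨ cong₂ _+_ one-fewer-down (ballot-last-return q (m<n⇒m<1+n q<p)) ⟩
  Σ′ + cat (suc q) + ∑ (suc q) (λ j → cat j * ballot (p ∸ j) (q ∸ j))
    ≡⟨ regroup Σ′ (cat (suc q)) _ ⟩
  Σ′ + ∑ (suc q) (λ j → cat j * ballot (p ∸ j) (q ∸ j)) + cat (suc q)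
    ≡⟨ cong₂ _+_ (sym (∑-+ (suc q) _ _)) (sym (trans (cong (cat (suc q) *_) ballot-at-0) (*-identityʳ _))) ⟩
  ∑ (suc q) (λ j → cat j * ballot (p ∸ suc j) (suc q ∸ j) + cat j * ballot (p ∸ j) (q ∸ j))
    + cat (suc q) * ballot (p ∸ suc q) (q ∸ q)
    ≡⟨ cong (_+ cat (suc q) * ballot (p ∸ suc q) (q ∸ q)) (∑-cong< (suc q) merge) ⟩
  ∑ (suc q) (λ j → cat j * ballot (p ∸ j) (suc q ∸ j)) + cat (suc q) * ballot (p ∸ suc q) (q ∸ q) ∎
  where
  open ≡-Reasoning
  Σ′ = ∑ (suc q) (λ j → cat j * ballot (p ∸ suc j) (suc q ∸ j))
  ballot-at-0 : ∀ {x} → ballot x (q ∸ q) ≡ 1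
  ballot-at-0 = cong (ballot _) (n∸n≡0 q)
  regroup : ∀ a b c → a + b + c ≡ a + c + b
  regroup = solve 3 (λ a b c → a :+ b :+ c := a :+ c :+ b) refl
  one-fewer-down : ballot p (suc q) ≡ Σ′ + cat (suc q)
  one-fewer-down with m≤n⇒m<n∨m≡n q<p
  ... | inj₁ 1+q<p = trans (ballot-last-return (suc q) 1+q<p)
                           (cong (Σ′ +_) (trans (cong (cat (suc q) *_) ballot-at-0) (*-identityʳ _)))
  ... | inj₂ refl  = cong (_+ cat (suc q)) (sym (∑-zero (suc q) too-many-downs))
    where
    too-many-downs : ∀ j → j < suc q → cat j * ballot (suc q ∸ suc j) (suc q ∸ j) ≡ 0
    too-many-downs j (s≤s j≤q) rewrite +-∸-assoc 1 j≤q =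
      trans (cong (cat j *_) (ballot-vanishes (n<1+n (q ∸ j)))) (*-zeroʳ (cat j))
  merge : ∀ j → j < suc q →
    cat j * ballot (p ∸ suc j) (suc q ∸ j) + cat j * ballot (p ∸ j) (q ∸ j) ≡ cat j * ballot (p ∸ j) (suc q ∸ j)
  merge j (s≤s j≤q) = trans (sym (*-distribˡ-+ (cat j) _ _)) (cong (cat j *_) (ballot-step-∸ j≤q q<p))

cat-convolution : ∀ q → cat (suc q) ≡ ∑ (suc q) (λ j → cat j * cat (q ∸ j))
cat-convolution q = begin
  ballot (suc q) (suc q)                 ≡⟨ ballot-step {q} ≤-refl ⟩
  ballot q (suc q) + ballot (suc q) q     ≡⟨ cong (_+ ballot (suc q) q) (ballot-vanishes (n<1+n q)) ⟩
  ballot (suc q) q                       ≡⟨ ballot-last-return q (n<1+n q) ⟩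
  ∑ (suc q) (λ j → cat j * cat (q ∸ j))  ∎
  where open ≡-Reasoning

Seq : Set
Seq = ℕ → ℕ → ℕ

infixl 7 _⊛_
_⊛_ : Seq → Seq → Seq
(f ⊛ g) L k = ∑ (suc L) (λ L₁ → ∑ (suc k) (λ k₁ → f L₁ k₁ * g (L ∸ L₁) (k ∸ k₁)))

δ : Seq
δ zero zero = 1
δ _    _    = 0

shift₁ : Seq → Seq
shift₁ f zero    k = 0
shift₁ f (suc L) k = f L k

shift₂ : Seq → Seq
shift₂ f L zero    = 0
shift₂ f L (suc k) = f L k

⊛-cong : ∀ {f f′ g g′} L k →
  (∀ L₁ k₁ → L₁ ≤ L → k₁ ≤ k → f L₁ k₁ ≡ f′ L₁ k₁) →
  (∀ L₁ k₁ → L₁ ≤ L → k₁ ≤ k → g L₁ k₁ ≡ g′ L₁ k₁) → (f ⊛ g) L k ≡ (f′ ⊛ g′) L k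
⊛-cong L k f≗f′ g≗g′ = ∑-cong< (suc L) (λ L₁ L₁≤L → ∑-cong< (suc k) (λ k₁ k₁≤k →
  cong₂ _*_ (f≗f′ L₁ k₁ (≤-pred L₁≤L) (≤-pred k₁≤k)) (g≗g′ (L ∸ L₁) (k ∸ k₁) (m∸n≤m L L₁) (m∸n≤m k k₁))))

⊛-congˡ : ∀ {f f′} g L k → (∀ L₁ k₁ → L₁ ≤ L → k₁ ≤ k → f L₁ k₁ ≡ f′ L₁ k₁) → (f ⊛ g) L k ≡ (f′ ⊛ g) L k
⊛-congˡ g L k f≗f′ = ⊛-cong {g = g} L k f≗f′ (λ _ _ _ _ → refl)

⊛-distribʳ-+ : ∀ f f′ g L k → ((λ a b → f a b + f′ a b) ⊛ g) L k ≡ (f ⊛ g) L k + (f′ ⊛ g) L k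
⊛-distribʳ-+ f f′ g L k = trans
  (∑-cong (suc L) (λ L₁ → trans (∑-cong (suc k) (λ k₁ → *-distribʳ-+ (g (L ∸ L₁) (k ∸ k₁)) (f L₁ k₁) (f′ L₁ k₁)))
                                (∑-+ (suc k) _ _)))
  (∑-+ (suc L) _ _)

⊛-*ˡ : ∀ c f g L k → ((λ a b → c * f a b) ⊛ g) L k ≡ c * (f ⊛ g) L k
⊛-*ˡ c f g L k = trans
  (∑-cong (suc L) (λ L₁ → trans (∑-cong (suc k) (λ k₁ → *-assoc c (f L₁ k₁) _)) (∑-*ˡ (suc k) c _)))
  (∑-*ˡ (suc L) c _)

⊛-∑ : ∀ n (F : ℕ → Seq) g L k → ((λ a b → ∑ n (λ s → F s a b)) ⊛ g) L k ≡ ∑ n (λ s → (F s ⊛ g) L k)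
⊛-∑ zero    F g L k = ∑-zero (suc L) (λ _ _ → ∑-zero (suc k) (λ _ _ → refl))
⊛-∑ (suc n) F g L k =
  trans (⊛-distribʳ-+ (λ a b → ∑ n (λ s → F s a b)) (F n) g L k) (cong (_+ (F n ⊛ g) L k) (⊛-∑ n F g L k))

δ-⊛ : ∀ g L k → (δ ⊛ g) L k ≡ g L k
δ-⊛ g L k =
  trans (∑-single (suc L) 0 _ z<s (λ { zero _ 0≢0 → ⊥-elim (0≢0 refl) ; (suc _) _ _ → ∑-zero (suc k) (λ _ _ → refl) }))
        (trans (∑-single (suc k) 0 _ z<s (λ { zero _ 0≢0 → ⊥-elim (0≢0 refl) ; (suc _) _ _ → refl }))
               (+-identityʳ (g L k)))

shift₁-⊛ : ∀ f g L k → (shift₁ f ⊛ g) (suc L) k ≡ (f ⊛ g) L k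
shift₁-⊛ f g L k = trans (∑-unfoldˡ (suc L) _) (cong (_+ (f ⊛ g) L k) (∑-zero (suc k) (λ _ _ → refl)))

shift₁-⊛-0 : ∀ f g k → (shift₁ f ⊛ g) 0 k ≡ 0
shift₁-⊛-0 f g k = ∑-zero (suc k) (λ _ _ → refl)

shift₂-⊛ : ∀ f g L k → (shift₂ f ⊛ g) L (suc k) ≡ (f ⊛ g) L k
shift₂-⊛ f g L k = ∑-cong (suc L) (λ L₁ → ∑-unfoldˡ (suc k) _)

shift₂-⊛-0 : ∀ f g L → (shift₂ f ⊛ g) L 0 ≡ 0
shift₂-⊛-0 f g L = ∑-zero (suc L) (λ _ _ → refl)

-- Motzkin numbers

-- motzkinTri n k = C(n, 2k) Cₖ counts the Motzkin paths of length n with k up-steps.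
motzkinTri : Seq
motzkinTri n k = binom n (k + k) * cat k

motzkinTri≡C*catalan : ∀ n k → motzkinTri n k ≡ (n C (2 * k)) * catalan k
motzkinTri≡C*catalan n k = cong₂ _*_ binom-2k (sym (catalan≡cat k))
  where
  binom-2k : binom n (k + k) ≡ n C (2 * k)
  binom-2k = trans (cong (λ x → binom n (k + x)) (sym (+-identityʳ k))) (binom≡C n (2 * k))

motzkinTri-vanishes : ∀ n k → n < k + k → motzkinTri n k ≡ 0
motzkinTri-vanishes n k n<2k = cong (_* _) (binom-vanishes n<2k)

motzkinTri-beyond : ∀ n i → n < i → motzkinTri n i ≡ 0
motzkinTri-beyond n i n<i = motzkinTri-vanishes n i (<-≤-trans n<i (m≤m+n i i))

∑-motzkinTri-products : ∀ L k {k₁} → k₁ ≤ k →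
  ∑ (suc L) (λ L₁ → motzkinTri L₁ k₁ * motzkinTri (L ∸ L₁) (k ∸ k₁)) ≡ (cat k₁ * cat (k ∸ k₁)) * binom (suc L) (suc (k + k))
∑-motzkinTri-products L k {k₁} k₁≤k = begin
  ∑ (suc L) (λ L₁ → motzkinTri L₁ k₁ * motzkinTri (L ∸ L₁) (k ∸ k₁))
    ≡⟨ ∑-cong (suc L) (λ L₁ → rearrange (binom L₁ (k₁ + k₁)) (cat k₁) (binom (L ∸ L₁) (k ∸ k₁ + (k ∸ k₁))) (cat (k ∸ k₁))) ⟩
  ∑ (suc L) (λ L₁ → (cat k₁ * cat (k ∸ k₁)) * (binom L₁ (k₁ + k₁) * binom (L ∸ L₁) (k ∸ k₁ + (k ∸ k₁))))
    ≡⟨ ∑-*ˡ (suc L) (cat k₁ * cat (k ∸ k₁)) _ ⟩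
  (cat k₁ * cat (k ∸ k₁)) * ∑ (suc L) (λ L₁ → binom L₁ (k₁ + k₁) * binom (L ∸ L₁) (k ∸ k₁ + (k ∸ k₁)))
    ≡⟨ cong (cat k₁ * cat (k ∸ k₁) *_) (chu-vandermonde L (k₁ + k₁) (k ∸ k₁ + (k ∸ k₁))) ⟩
  (cat k₁ * cat (k ∸ k₁)) * binom (suc L) (suc (k₁ + k₁ + (k ∸ k₁ + (k ∸ k₁))))
    ≡⟨ cong (λ x → cat k₁ * cat (k ∸ k₁) * binom (suc L) (suc x)) two-halves ⟩
  (cat k₁ * cat (k ∸ k₁)) * binom (suc L) (suc (k + k)) ∎
  where
  open ≡-Reasoning
  rearrange : ∀ a b c e → a * b * (c * e) ≡ (b * e) * (a * c)
  rearrange = solve 4 (λ a b c e → a :* b :* (c :* e) := (b :* e) :* (a :* c)) refl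
  two-halves : k₁ + k₁ + (k ∸ k₁ + (k ∸ k₁)) ≡ k + k
  two-halves = trans (solve 2 (λ a b → a :+ a :+ (b :+ b) := a :+ b :+ (a :+ b)) refl k₁ (k ∸ k₁))
                     (cong₂ _+_ (m+[n∸m]≡n k₁≤k) (m+[n∸m]≡n k₁≤k))

motzkinTri⊛motzkinTri : ∀ L k → (motzkinTri ⊛ motzkinTri) L k ≡ binom (suc L) (suc (k + k)) * cat (suc k)
motzkinTri⊛motzkinTri L k = begin
  (motzkinTri ⊛ motzkinTri) L k
    ≡⟨ ∑-comm (suc L) (suc k) _ ⟩
  ∑ (suc k) (λ k₁ → ∑ (suc L) (λ L₁ → motzkinTri L₁ k₁ * motzkinTri (L ∸ L₁) (k ∸ k₁)))
    ≡⟨ ∑-cong< (suc k) (λ k₁ k₁<1+k → ∑-motzkinTri-products L k (≤-pred k₁<1+k)) ⟩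
  ∑ (suc k) (λ k₁ → (cat k₁ * cat (k ∸ k₁)) * binom (suc L) (suc (k + k)))
    ≡⟨ ∑-*ʳ (suc k) _ _ ⟩
  ∑ (suc k) (λ k₁ → cat k₁ * cat (k ∸ k₁)) * binom (suc L) (suc (k + k))
    ≡⟨ cong (_* binom (suc L) (suc (k + k))) (sym (cat-convolution k)) ⟩
  cat (suc k) * binom (suc L) (suc (k + k))
    ≡⟨ *-comm (cat (suc k)) _ ⟩
  binom (suc L) (suc (k + k)) * cat (suc k) ∎
  where open ≡-Reasoning

-- A Motzkin path starts with a flat step, or is U P D Q with Motzkin paths P and Q.
motzkinTri-rec : ∀ L k → motzkinTri (suc (suc L)) (suc k) ≡ motzkinTri (suc L) (suc k) + (motzkinTri ⊛ motzkinTri) L k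
motzkinTri-rec L k = begin
  binom (suc (suc L)) (suc k + suc k) * cat (suc k)
    ≡⟨ cong (λ x → binom (suc (suc L)) (suc x) * cat (suc k)) (+-suc k k) ⟩
  (binom (suc L) (suc (k + k)) + binom (suc L) (suc (suc (k + k)))) * cat (suc k)
    ≡⟨ *-distribʳ-+ (cat (suc k)) (binom (suc L) (suc (k + k))) _ ⟩
  binom (suc L) (suc (k + k)) * cat (suc k) + binom (suc L) (suc (suc (k + k))) * cat (suc k)
    ≡⟨ +-comm (binom (suc L) (suc (k + k)) * cat (suc k)) _ ⟩
  binom (suc L) (suc (suc (k + k))) * cat (suc k) + binom (suc L) (suc (k + k)) * cat (suc k)
    ≡⟨ cong₂ _+_ (cong (λ x → binom (suc L) (suc x) * cat (suc k)) (sym (+-suc k k))) (sym (motzkinTri⊛motzkinTri L k)) ⟩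
  motzkinTri (suc L) (suc k) + (motzkinTri ⊛ motzkinTri) L k ∎
  where open ≡-Reasoning

motzkinRow : ℕ → ℕ
motzkinRow n = ∑ (suc n) (motzkinTri n)

∑-cauchy : ∀ K (f g : ℕ → ℕ) → ∑ K (λ k → ∑ (suc k) (λ k₁ → f k₁ * g (k ∸ k₁))) ≡ ∑ K (λ k₁ → f k₁ * ∑ (K ∸ k₁) g)
∑-cauchy zero    f g = refl
∑-cauchy (suc K) f g = begin
  ∑ K (λ k → ∑ (suc k) (λ k₁ → f k₁ * g (k ∸ k₁))) + (∑ K (λ k₁ → f k₁ * g (K ∸ k₁)) + f K * g (K ∸ K))
    ≡⟨ cong (_+ (∑ K (λ k₁ → f k₁ * g (K ∸ k₁)) + f K * g (K ∸ K))) (∑-cauchy K f g) ⟩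
  ∑ K (λ k₁ → f k₁ * ∑ (K ∸ k₁) g) + (∑ K (λ k₁ → f k₁ * g (K ∸ k₁)) + f K * g (K ∸ K))
    ≡⟨ sym (+-assoc (∑ K (λ k₁ → f k₁ * ∑ (K ∸ k₁) g)) _ _) ⟩
  ∑ K (λ k₁ → f k₁ * ∑ (K ∸ k₁) g) + ∑ K (λ k₁ → f k₁ * g (K ∸ k₁)) + f K * g (K ∸ K)
    ≡⟨ cong₂ _+_ (sym (∑-+ K _ _)) (cong (λ x → f K * g x) (n∸n≡0 K)) ⟩
  ∑ K (λ k₁ → f k₁ * ∑ (K ∸ k₁) g + f k₁ * g (K ∸ k₁)) + f K * g 0
    ≡⟨ cong₂ _+_ (∑-cong< K extend) (cong (λ x → f K * ∑ x g) (sym (trans (+-∸-assoc 1 (≤-refl {K})) (cong suc (n∸n≡0 K))))) ⟩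
  ∑ K (λ k₁ → f k₁ * ∑ (suc K ∸ k₁) g) + f K * ∑ (suc K ∸ K) g ∎
  where
  open ≡-Reasoning
  extend : ∀ k₁ → k₁ < K → f k₁ * ∑ (K ∸ k₁) g + f k₁ * g (K ∸ k₁) ≡ f k₁ * ∑ (suc K ∸ k₁) g
  extend k₁ k₁<K rewrite +-∸-assoc 1 (<⇒≤ k₁<K) = sym (*-distribˡ-+ (f k₁) (∑ (K ∸ k₁) g) (g (K ∸ k₁)))

motzkinRow-product : ∀ L L₁ → L₁ ≤ L →
  ∑ (suc (suc L)) (λ k → ∑ (suc k) (λ k₁ → motzkinTri L₁ k₁ * motzkinTri (L ∸ L₁) (k ∸ k₁)))
    ≡ motzkinRow L₁ * motzkinRow (L ∸ L₁)
motzkinRow-product L L₁ L₁≤L = begin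
  ∑ K (λ k → ∑ (suc k) (λ k₁ → motzkinTri L₁ k₁ * motzkinTri (L ∸ L₁) (k ∸ k₁)))
    ≡⟨ ∑-cauchy K (motzkinTri L₁) (motzkinTri (L ∸ L₁)) ⟩
  ∑ K (λ k₁ → motzkinTri L₁ k₁ * ∑ (K ∸ k₁) (motzkinTri (L ∸ L₁)))
    ≡⟨ ∑-cong< K inner ⟩
  ∑ K (λ k₁ → motzkinTri L₁ k₁ * motzkinRow (L ∸ L₁))
    ≡⟨ ∑-*ʳ K (motzkinRow (L ∸ L₁)) (motzkinTri L₁) ⟩
  ∑ K (motzkinTri L₁) * motzkinRow (L ∸ L₁)
    ≡⟨ cong (_* motzkinRow (L ∸ L₁)) (∑-extend (suc L₁) K (s≤s (m≤n⇒m≤1+n L₁≤L)) (motzkinTri-beyond L₁)) ⟩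
  motzkinRow L₁ * motzkinRow (L ∸ L₁) ∎
  where
  open ≡-Reasoning
  K = suc (suc L)
  room : ∀ {k₁} → k₁ ≤ L₁ → suc (L ∸ L₁) ≤ K ∸ k₁
  room {k₁} k₁≤L₁ = ≤-trans (s≤s (∸-monoʳ-≤ L k₁≤L₁)) (≤-trans (n≤1+n _) (≤-reflexive (sym K∸k₁)))
    where
    K∸k₁ : K ∸ k₁ ≡ suc (suc (L ∸ k₁))
    K∸k₁ = trans (+-∸-assoc 1 (≤-trans k₁≤L₁ (m≤n⇒m≤1+n L₁≤L))) (cong suc (+-∸-assoc 1 (≤-trans k₁≤L₁ L₁≤L)))
  inner : ∀ k₁ → k₁ < K → motzkinTri L₁ k₁ * ∑ (K ∸ k₁) (motzkinTri (L ∸ L₁)) ≡ motzkinTri L₁ k₁ * motzkinRow (L ∸ L₁)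
  inner k₁ _ with k₁ ≤? L₁
  ... | yes k₁≤L₁ = cong (motzkinTri L₁ k₁ *_) (∑-extend _ (K ∸ k₁) (room k₁≤L₁) (motzkinTri-beyond (L ∸ L₁)))
  ... | no  k₁≰L₁ rewrite motzkinTri-beyond L₁ k₁ (≰⇒> k₁≰L₁) = refl

motzkinRow-rec : ∀ L → motzkinRow (suc (suc L)) ≡ motzkinRow (suc L) + ∑ (suc L) (λ i → motzkinRow i * motzkinRow (L ∸ i))
motzkinRow-rec L = begin
  motzkinRow (suc (suc L))
    ≡⟨ ∑-unfoldˡ (suc (suc L)) _ ⟩
  1 + ∑ (suc (suc L)) (λ k → motzkinTri (suc (suc L)) (suc k))
    ≡⟨ cong (1 +_) (∑-cong (suc (suc L)) (motzkinTri-rec L)) ⟩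
  1 + ∑ (suc (suc L)) (λ k → motzkinTri (suc L) (suc k) + (motzkinTri ⊛ motzkinTri) L k)
    ≡⟨ cong (1 +_) (∑-+ (suc (suc L)) _ _) ⟩
  1 + (∑ (suc (suc L)) (λ k → motzkinTri (suc L) (suc k)) + ∑ (suc (suc L)) ((motzkinTri ⊛ motzkinTri) L))
    ≡⟨ sym (+-assoc 1 (∑ (suc (suc L)) (λ k → motzkinTri (suc L) (suc k))) _) ⟩
  (1 + ∑ (suc (suc L)) (λ k → motzkinTri (suc L) (suc k))) + ∑ (suc (suc L)) ((motzkinTri ⊛ motzkinTri) L)
    ≡⟨ cong₂ _+_ flat-first up-first ⟩
  motzkinRow (suc L) + ∑ (suc L) (λ i → motzkinRow i * motzkinRow (L ∸ i)) ∎
  where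
  open ≡-Reasoning
  flat-first : 1 + ∑ (suc (suc L)) (λ k → motzkinTri (suc L) (suc k)) ≡ motzkinRow (suc L)
  flat-first = trans (sym (∑-unfoldˡ (suc (suc L)) (motzkinTri (suc L))))
                     (∑-extend (suc (suc L)) (suc (suc (suc L))) (n≤1+n _) (motzkinTri-beyond (suc L)))
  up-first : ∑ (suc (suc L)) ((motzkinTri ⊛ motzkinTri) L) ≡ ∑ (suc L) (λ i → motzkinRow i * motzkinRow (L ∸ i))
  up-first = trans (∑-comm (suc (suc L)) (suc L) _) (∑-cong< (suc L) (λ L₁ L₁<1+L → motzkinRow-product L L₁ (≤-pred L₁<1+L)))

at-++ˡ : ∀ xs ys {i} → i < length xs → at (xs ++ ys) i ≡ at xs i
at-++ˡ (x ∷ xs) ys {zero}  _         = refl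
at-++ˡ (x ∷ xs) ys {suc i} (s≤s i<n) = at-++ˡ xs ys i<n

at-++-length : ∀ xs y ys → at (xs ++ y ∷ ys) (length xs) ≡ y
at-++-length []       y ys = refl
at-++-length (x ∷ xs) y ys = at-++-length xs y ys

length-motzUpTo : ∀ n → length (motzUpTo n) ≡ suc n
length-motzUpTo zero    = refl
length-motzUpTo (suc n) = trans (length-++ (motzUpTo n)) (trans (cong (_+ 1) (length-motzUpTo n)) (+-comm (suc n) 1))

at-motzUpTo : ∀ n i → i ≤ n → at (motzUpTo n) i ≡ motzkinRow i
at-motzUpTo zero    zero _   = refl
at-motzUpTo (suc n) i i≤1+n with m≤n⇒m<n∨m≡n i≤1+n
... | inj₁ (s≤s i≤n) = trans (at-++ˡ (motzUpTo n) _ (subst (i <_) (sym (length-motzUpTo n)) (s≤s i≤n)))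
                             (at-motzUpTo n i i≤n)
... | inj₂ refl = begin
  at (Ms ++ [ new ]) (suc n)        ≡⟨ cong (at (Ms ++ [ new ])) (sym (length-motzUpTo n)) ⟩
  at (Ms ++ [ new ]) (length Ms)    ≡⟨ at-++-length Ms new [] ⟩
  new                               ≡⟨ cong₂ _+_ (at-motzUpTo n n ≤-refl) (trans (sum-map-upTo n _) (∑-cong< n products)) ⟩
  motzkinRow n + ∑ n (λ j → motzkinRow j * motzkinRow (n ∸ 1 ∸ j)) ≡⟨ recurrence n ⟩
  motzkinRow (suc n)                ∎
  where
  open ≡-Reasoning
  Ms = motzUpTo n
  new = at Ms n + sum (map (λ j → at Ms j * at Ms (n ∸ 1 ∸ j)) (upTo n))
  products : ∀ j → j < n → at Ms j * at Ms (n ∸ 1 ∸ j) ≡ motzkinRow j * motzkinRow (n ∸ 1 ∸ j)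
  products j j<n = cong₂ _*_ (at-motzUpTo n j (<⇒≤ j<n)) (at-motzUpTo n (n ∸ 1 ∸ j) (≤-trans (m∸n≤m _ j) (m∸n≤m n 1)))
  recurrence : ∀ n → motzkinRow n + ∑ n (λ j → motzkinRow j * motzkinRow (n ∸ 1 ∸ j)) ≡ motzkinRow (suc n)
  recurrence zero    = refl
  recurrence (suc L) = sym (motzkinRow-rec L)

motzkin≡motzkinRow : ∀ n → motzkin n ≡ motzkinRow n
motzkin≡motzkinRow n = at-motzUpTo n n ≤-refl

-- Tails and first passages

-- tails L t k counts the ways to finish a good permutation with L letters left, t of them
-- below the current maximum, and k descents still to come (this is transfer≡tails below).
tails : ℕ → ℕ → ℕ → ℕ
tails zero                t k       = δ t k
tails (suc zero)          t k       = δ (t ∸ 1) k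
tails (suc (suc L))       t zero    = tails (suc L) (t ∸ 1) zero
tails (suc (suc L))       t (suc k) = tails (suc L) (t ∸ 1) (suc k) + ∑ (suc L) (λ s → 𝟙 (t ∸ 1 ≤ᵇ s) * tails L s k)

-- The same recurrence, stopped when no letter is left below the maximum.
firstPassage : ℕ → ℕ → ℕ → ℕ
firstPassage zero          t       k       = δ t k
firstPassage (suc L)       zero    k       = 0
firstPassage (suc zero)    (suc t) k       = δ t k
firstPassage (suc (suc L)) (suc t) zero    = firstPassage (suc L) t zero
firstPassage (suc (suc L)) (suc t) (suc k) =
  firstPassage (suc L) t (suc k) + ∑ (suc L) (λ s → 𝟙 (t ≤ᵇ s) * firstPassage L s k)

tails₀ : Seq
tails₀ L k = tails L 0 k

firstPassageFrom : ℕ → Seq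
firstPassageFrom t L k = firstPassage L t k

δ-suc : ∀ t k → δ (suc t) k ≡ 0
δ-suc t zero    = refl
δ-suc t (suc k) = refl

tails-vanishes : ∀ L t k → L < t → tails L t k ≡ 0
tails-vanishes zero          (suc t)       k       _         = δ-suc t k
tails-vanishes (suc zero)    (suc (suc t)) k       _         = δ-suc t k
tails-vanishes (suc zero)    (suc zero)    k       (s≤s ())
tails-vanishes (suc (suc L)) (suc t)       zero    (s≤s L<t) = tails-vanishes (suc L) t zero L<t
tails-vanishes (suc (suc L)) (suc t)       (suc k) (s≤s L<t)
  rewrite tails-vanishes (suc L) t (suc k) L<t =
  ∑-zero (suc L) (λ s s≤L → cong (λ b → 𝟙 b * tails L s k) (≤ᵇ-false (<-trans s≤L L<t)))

firstPassage-vanishes : ∀ L t k → L < t → firstPassage L t k ≡ 0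
firstPassage-vanishes zero          (suc t)       k       _         = δ-suc t k
firstPassage-vanishes (suc zero)    (suc (suc t)) k       _         = δ-suc t k
firstPassage-vanishes (suc zero)    (suc zero)    k       (s≤s ())
firstPassage-vanishes (suc (suc L)) (suc t)       zero    (s≤s L<t) = firstPassage-vanishes (suc L) t zero L<t
firstPassage-vanishes (suc (suc L)) (suc t)       (suc k) (s≤s L<t)
  rewrite firstPassage-vanishes (suc L) t (suc k) L<t =
  ∑-zero (suc L) (λ s s≤L → cong (λ b → 𝟙 b * firstPassage L s k) (≤ᵇ-false (<-trans s≤L L<t)))

firstPassage-0 : ∀ L k → firstPassage L 0 k ≡ δ L k
firstPassage-0 zero    k       = refl
firstPassage-0 (suc L) zero    = refl
firstPassage-0 (suc L) (suc k) = refl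

firstPassageAbove : ℕ → ℕ → Seq
firstPassageAbove N r L k = ∑ (suc N) (λ s → 𝟙 (r ≤ᵇ s) * firstPassage L s k)

firstPassage-unfold : ∀ N t L k → L ≤ suc (suc N) →
  firstPassage L (suc t) k ≡ shift₁ (firstPassageFrom t) L k + shift₁ (shift₁ (shift₂ (firstPassageAbove N t))) L k
firstPassage-unfold N t zero                k       _ = refl
firstPassage-unfold N t (suc zero)          k       _ = sym (+-identityʳ _)
firstPassage-unfold N t (suc (suc L))       zero    _ = sym (+-identityʳ _)
firstPassage-unfold N t (suc (suc L))       (suc k) (s≤s (s≤s L≤N)) =
  cong (firstPassage (suc L) t (suc k) +_) (sym (∑-extend (suc L) (suc N) (s≤s L≤N)
    (λ s L<s → trans (cong (𝟙 (t ≤ᵇ s) *_) (firstPassage-vanishes L s k L<s)) (*-zeroʳ (𝟙 (t ≤ᵇ s))))))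

firstPassage⊛-unfold : ∀ N t g L k → L ≤ suc N →
  (firstPassageFrom (suc t) ⊛ g) (suc L) k
    ≡ (firstPassageFrom t ⊛ g) L k + (shift₁ (shift₂ (firstPassageAbove N t)) ⊛ g) L k
firstPassage⊛-unfold N t g L k L≤1+N = begin
  (firstPassageFrom (suc t) ⊛ g) (suc L) k
    ≡⟨ ⊛-congˡ g (suc L) k (λ a b a≤1+L _ → firstPassage-unfold N t a b (≤-trans a≤1+L (s≤s L≤1+N))) ⟩
  ((λ a b → shift₁ R a b + shift₁ (shift₁ (shift₂ A)) a b) ⊛ g) (suc L) k
    ≡⟨ ⊛-distribʳ-+ (shift₁ R) (shift₁ (shift₁ (shift₂ A))) g (suc L) k ⟩
  (shift₁ R ⊛ g) (suc L) k + (shift₁ (shift₁ (shift₂ A)) ⊛ g) (suc L) k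
    ≡⟨ cong₂ _+_ (shift₁-⊛ R g L k) (shift₁-⊛ (shift₁ (shift₂ A)) g L k) ⟩
  (R ⊛ g) L k + (shift₁ (shift₂ A) ⊛ g) L k ∎
  where
  open ≡-Reasoning
  R = firstPassageFrom t
  A = firstPassageAbove N t

-- A tail decomposes at the first moment no letter is left below the maximum.
tails≡firstPassage⊛tails₀ : ∀ L t k → tails L t k ≡ (firstPassageFrom t ⊛ tails₀) L k
tails≡firstPassage⊛tails₀ L zero k =
  sym (trans (⊛-congˡ tails₀ L k (λ a b _ _ → firstPassage-0 a b)) (δ-⊛ tails₀ L k))
tails≡firstPassage⊛tails₀ zero (suc t) k =
  sym (∑-zero 1 {λ L₁ → ∑ (suc k) (λ k₁ → firstPassage L₁ (suc t) k₁ * tails₀ (0 ∸ L₁) (k ∸ k₁))}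
                (λ { zero _ → ∑-zero (suc k) (λ k₁ _ → cong (_* tails₀ 0 (k ∸ k₁)) (δ-suc t k₁)) ; (suc _) (s≤s ()) }))
tails≡firstPassage⊛tails₀ (suc zero) (suc t) k = begin
  tails 0 t k
    ≡⟨ tails≡firstPassage⊛tails₀ 0 t k ⟩
  (firstPassageFrom t ⊛ tails₀) 0 k
    ≡⟨ sym (+-identityʳ _) ⟩
  (firstPassageFrom t ⊛ tails₀) 0 k + 0
    ≡⟨ cong ((firstPassageFrom t ⊛ tails₀) 0 k +_) (sym (shift₁-⊛-0 (shift₂ (firstPassageAbove 0 t)) tails₀ k)) ⟩
  (firstPassageFrom t ⊛ tails₀) 0 k + (shift₁ (shift₂ (firstPassageAbove 0 t)) ⊛ tails₀) 0 k
    ≡⟨ sym (firstPassage⊛-unfold 0 t tails₀ 0 k z≤n) ⟩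
  (firstPassageFrom (suc t) ⊛ tails₀) 1 k ∎
  where open ≡-Reasoning
tails≡firstPassage⊛tails₀ (suc (suc L)) (suc t) k = begin
  tails (suc (suc L)) (suc t) k
    ≡⟨ unfold k ⟩
  tails (suc L) t k + (shift₂ A ⊛ tails₀) L k
    ≡⟨ cong₂ _+_ (tails≡firstPassage⊛tails₀ (suc L) t k) (sym (shift₁-⊛ (shift₂ A) tails₀ L k)) ⟩
  (firstPassageFrom t ⊛ tails₀) (suc L) k + (shift₁ (shift₂ A) ⊛ tails₀) (suc L) k
    ≡⟨ sym (firstPassage⊛-unfold L t tails₀ (suc L) k ≤-refl) ⟩
  (firstPassageFrom (suc t) ⊛ tails₀) (suc (suc L)) k ∎
  where
  open ≡-Reasoning
  A = firstPassageAbove L t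
  climbs : ∀ k → (A ⊛ tails₀) L k ≡ ∑ (suc L) (λ s → 𝟙 (t ≤ᵇ s) * tails L s k)
  climbs k = begin
    (A ⊛ tails₀) L k
      ≡⟨ ⊛-∑ (suc L) (λ s a b → 𝟙 (t ≤ᵇ s) * firstPassage a s b) tails₀ L k ⟩
    ∑ (suc L) (λ s → ((λ a b → 𝟙 (t ≤ᵇ s) * firstPassage a s b) ⊛ tails₀) L k)
      ≡⟨ ∑-cong (suc L) (λ s → ⊛-*ˡ (𝟙 (t ≤ᵇ s)) (firstPassageFrom s) tails₀ L k) ⟩
    ∑ (suc L) (λ s → 𝟙 (t ≤ᵇ s) * (firstPassageFrom s ⊛ tails₀) L k)
      ≡⟨ ∑-cong (suc L) (λ s → cong (𝟙 (t ≤ᵇ s) *_) (sym (tails≡firstPassage⊛tails₀ L s k))) ⟩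
    ∑ (suc L) (λ s → 𝟙 (t ≤ᵇ s) * tails L s k) ∎
  unfold : ∀ k → tails (suc (suc L)) (suc t) k ≡ tails (suc L) t k + (shift₂ A ⊛ tails₀) L k
  unfold zero    = sym (trans (cong (tails (suc L) t zero +_) (shift₂-⊛-0 A tails₀ L)) (+-identityʳ _))
  unfold (suc k) = cong (tails (suc L) t (suc k) +_) (sym (trans (shift₂-⊛ A tails₀ L k) (climbs k)))

firstPassageAbove-unfoldˡ : ∀ N r L k →
  firstPassageAbove (suc N) r (suc L) k ≡ ∑ (suc N) (λ s → 𝟙 (r ∸ 1 ≤ᵇ s) * firstPassage (suc L) (suc s) k)
firstPassageAbove-unfoldˡ N r L k = begin
  firstPassageAbove (suc N) r (suc L) k
    ≡⟨ ∑-unfoldˡ (suc N) _ ⟩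
  𝟙 (r ≤ᵇ 0) * 0 + ∑ (suc N) (λ s → 𝟙 (r ≤ᵇ suc s) * firstPassage (suc L) (suc s) k)
    ≡⟨ cong₂ _+_ (*-zeroʳ (𝟙 (r ≤ᵇ 0))) (∑-cong (suc N) (λ s → cong (λ b → 𝟙 b * _) (≤ᵇ-suc r s))) ⟩
  ∑ (suc N) (λ s → 𝟙 (r ∸ 1 ≤ᵇ s) * firstPassage (suc L) (suc s) k) ∎
  where open ≡-Reasoning

firstPassageAbove≡tails : ∀ L r k → firstPassageAbove L r L k ≡ tails L r k
firstPassageAbove≡tails zero          zero          zero    = refl
firstPassageAbove≡tails zero          zero          (suc k) = refl
firstPassageAbove≡tails zero          (suc r)       k       = sym (δ-suc r k)
firstPassageAbove≡tails (suc zero)    zero          zero    = refl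
firstPassageAbove≡tails (suc zero)    zero          (suc k) = refl
firstPassageAbove≡tails (suc zero)    (suc zero)    zero    = refl
firstPassageAbove≡tails (suc zero)    (suc zero)    (suc k) = refl
firstPassageAbove≡tails (suc zero)    (suc (suc r)) k       =
  trans (cong (_+ 𝟙 (r <ᵇ 0) * δ 0 k) (*-zeroʳ (𝟙 (r <ᵇ 0)))) (sym (δ-suc r k))
firstPassageAbove≡tails (suc (suc L)) r             zero    =
  trans (firstPassageAbove-unfoldˡ (suc L) r (suc L) zero) (firstPassageAbove≡tails (suc L) (r ∸ 1) zero)
firstPassageAbove≡tails (suc (suc L)) r             (suc k) = begin
  firstPassageAbove (suc (suc L)) r (suc (suc L)) (suc k)
    ≡⟨ firstPassageAbove-unfoldˡ (suc L) r (suc L) (suc k) ⟩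
  ∑ (suc (suc L)) (λ s → 𝟙 (r′ ≤ᵇ s) * (firstPassage (suc L) s (suc k) + firstPassageAbove L s L k))
    ≡⟨ ∑-cong (suc (suc L)) (λ s → *-distribˡ-+ (𝟙 (r′ ≤ᵇ s)) (firstPassage (suc L) s (suc k)) _) ⟩
  ∑ (suc (suc L)) (λ s → 𝟙 (r′ ≤ᵇ s) * firstPassage (suc L) s (suc k) + 𝟙 (r′ ≤ᵇ s) * firstPassageAbove L s L k)
    ≡⟨ ∑-+ (suc (suc L)) _ _ ⟩
  firstPassageAbove (suc L) r′ (suc L) (suc k) + ∑ (suc (suc L)) (λ s → 𝟙 (r′ ≤ᵇ s) * firstPassageAbove L s L k)
    ≡⟨ cong₂ _+_ (firstPassageAbove≡tails (suc L) r′ (suc k)) second ⟩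
  tails (suc L) r′ (suc k) + ∑ (suc L) (λ s → 𝟙 (r′ ≤ᵇ s) * tails L s k) ∎
  where
  open ≡-Reasoning
  r′ = r ∸ 1
  last-vanishes : firstPassageAbove L (suc L) L k ≡ 0
  last-vanishes = ∑-zero (suc L) (λ s s≤L → cong (λ b → 𝟙 b * firstPassage L s k) (≤ᵇ-false s≤L))
  second : ∑ (suc (suc L)) (λ s → 𝟙 (r′ ≤ᵇ s) * firstPassageAbove L s L k) ≡ ∑ (suc L) (λ s → 𝟙 (r′ ≤ᵇ s) * tails L s k)
  second = begin
    ∑ (suc L) (λ s → 𝟙 (r′ ≤ᵇ s) * firstPassageAbove L s L k) + 𝟙 (r′ ≤ᵇ suc L) * firstPassageAbove L (suc L) L k
      ≡⟨ cong₂ _+_ (∑-cong (suc L) (λ s → cong (𝟙 (r′ ≤ᵇ s) *_) (firstPassageAbove≡tails L s k)))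
                   (trans (cong (𝟙 (r′ ≤ᵇ suc L) *_) last-vanishes) (*-zeroʳ (𝟙 (r′ ≤ᵇ suc L)))) ⟩
    ∑ (suc L) (λ s → 𝟙 (r′ ≤ᵇ s) * tails L s k) + 0
      ≡⟨ +-identityʳ _ ⟩
    ∑ (suc L) (λ s → 𝟙 (r′ ≤ᵇ s) * tails L s k) ∎

∑tails≡tails₀⊛tails₀ : ∀ L k → ∑ (suc L) (λ s → tails L s k) ≡ (tails₀ ⊛ tails₀) L k
∑tails≡tails₀⊛tails₀ L k = begin
  ∑ (suc L) (λ s → tails L s k)                                     ≡⟨ ∑-cong (suc L) (λ s → tails≡firstPassage⊛tails₀ L s k) ⟩
  ∑ (suc L) (λ s → (firstPassageFrom s ⊛ tails₀) L k)               ≡⟨ sym (⊛-∑ (suc L) firstPassageFrom tails₀ L k) ⟩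
  ((λ a b → ∑ (suc L) (λ s → firstPassage a s b)) ⊛ tails₀) L k     ≡⟨ ⊛-congˡ tails₀ L k all-heights ⟩
  (tails₀ ⊛ tails₀) L k                                             ∎
  where
  open ≡-Reasoning
  all-heights : ∀ a b → a ≤ L → b ≤ k → ∑ (suc L) (λ s → firstPassage a s b) ≡ tails₀ a b
  all-heights a b a≤L _ = begin
    ∑ (suc L) (λ s → firstPassage a s b) ≡⟨ ∑-extend (suc a) (suc L) (s≤s a≤L) (λ s a<s → firstPassage-vanishes a s b a<s) ⟩
    ∑ (suc a) (λ s → firstPassage a s b) ≡⟨ ∑-cong (suc a) (λ s → sym (+-identityʳ (firstPassage a s b))) ⟩
    firstPassageAbove a 0 a b           ≡⟨ firstPassageAbove≡tails a 0 b ⟩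
    tails₀ a b                           ∎

tails₀-rec : ∀ L k → tails₀ (suc (suc L)) (suc k) ≡ tails₀ (suc L) (suc k) + (tails₀ ⊛ tails₀) L k
tails₀-rec L k = cong (tails₀ (suc L) (suc k) +_) (trans (∑-cong (suc L) (λ s → +-identityʳ (tails L s k))) (∑tails≡tails₀⊛tails₀ L k))

tails₀-0 : ∀ L → tails₀ L 0 ≡ 1
tails₀-0 zero          = refl
tails₀-0 (suc zero)    = refl
tails₀-0 (suc (suc L)) = tails₀-0 (suc L)

tails₀≡motzkinTri : ∀ L k → tails₀ L k ≡ motzkinTri L k
tails₀≡motzkinTri L k = go L L k ≤-refl
  where
  go : ∀ n L k → L ≤ n → tails₀ L k ≡ motzkinTri L k
  go n       L             zero    _ = tails₀-0 L
  go n       zero          (suc k) _ = sym (motzkinTri-beyond 0 (suc k) z<s)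
  go n       (suc zero)    (suc k) _ = sym (motzkinTri-vanishes 1 (suc k) (s≤s (≤-trans (s≤s z≤n) (m≤n+m (suc k) k))))
  go (suc n) (suc (suc L)) (suc k) (s≤s L<n) = begin
    tails₀ (suc (suc L)) (suc k)                  ≡⟨ tails₀-rec L k ⟩
    tails₀ (suc L) (suc k) + (tails₀ ⊛ tails₀) L k ≡⟨ cong₂ _+_ (go n (suc L) (suc k) L<n) (⊛-cong L k ih ih) ⟩
    motzkinTri (suc L) (suc k) + (motzkinTri ⊛ motzkinTri) L k ≡⟨ sym (motzkinTri-rec L k) ⟩
    motzkinTri (suc (suc L)) (suc k)              ∎
    where
    open ≡-Reasoning
    ih : ∀ a b → a ≤ L → b ≤ k → tails₀ a b ≡ motzkinTri a b
    ih a b a≤L _ = go n a b (≤-trans a≤L (≤-trans (n≤1+n L) L<n))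

count-∷ : ∀ {A : Set} (p : A → Bool) x xs → count p (x ∷ xs) ≡ 𝟙 (p x) + count p xs
count-∷ p x xs with p x
... | true  = refl
... | false = refl

count-++ : ∀ {A : Set} (p : A → Bool) xs ys → count p (xs ++ ys) ≡ count p xs + count p ys
count-++ p []       ys = refl
count-++ p (x ∷ xs) ys rewrite count-∷ p x (xs ++ ys) | count-∷ p x xs | count-++ p xs ys =
  sym (+-assoc (𝟙 (p x)) _ _)

count-cong : ∀ {A : Set} {p q : A → Bool} xs → (∀ x → p x ≡ q x) → count p xs ≡ count q xs
count-cong     []       p≗q = refl
count-cong {p = p} {q} (x ∷ xs) p≗q rewrite count-∷ p x xs | count-∷ q x xs | p≗q x | count-cong xs p≗q = refl

count-map : ∀ {A B : Set} (p : B → Bool) (f : A → B) xs → count p (map f xs) ≡ count (p ∘ f) xs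
count-map p f []       = refl
count-map p f (x ∷ xs) rewrite count-∷ p (f x) (map f xs) | count-∷ (p ∘ f) x xs | count-map p f xs = refl

count-filterᵇ : ∀ {A : Set} (p q : A → Bool) xs → count p (filterᵇ q xs) ≡ count (λ x → q x ∧ p x) xs
count-filterᵇ p q []       = refl
count-filterᵇ p q (x ∷ xs) rewrite count-∷ (λ y → q y ∧ p y) x xs with q x
... | true  = trans (count-∷ p x (filterᵇ q xs)) (cong (𝟙 (p x) +_) (count-filterᵇ p q xs))
... | false = count-filterᵇ p q xs

count-≤-length : ∀ {A : Set} (p : A → Bool) xs → count p xs ≤ length xs
count-≤-length p []       = z≤n
count-≤-length p (x ∷ xs) with p x
... | true  = s≤s (count-≤-length p xs)
... | false = m≤n⇒m≤1+n (count-≤-length p xs)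

count-true : ∀ {A : Set} (xs : List A) → count (λ _ → true) xs ≡ length xs
count-true []       = refl
count-true (x ∷ xs) = cong suc (count-true xs)

count-false : ∀ {A : Set} (xs : List A) → count (λ _ → false) xs ≡ 0
count-false []       = refl
count-false (x ∷ xs) = count-false xs

count-guard : ∀ {A : Set} b (p : A → Bool) xs → count (λ x → b ∧ p x) xs ≡ (if b then count p xs else 0)
count-guard true  p xs = refl
count-guard false p xs = count-false xs

count-concatMap : ∀ {A B : Set} (p : B → Bool) (f : A → List B) xs →
  count p (concatMap f xs) ≡ sum (map (λ x → count p (f x)) xs)
count-concatMap p f []       = refl
count-concatMap p f (x ∷ xs) = trans (count-++ p (f x) (concatMap f xs)) (cong (count p (f x) +_) (count-concatMap p f xs))

sum-map-tabulate : ∀ {X : Set} K (f : Fin K → X) (g : X → ℕ) (h : ℕ → ℕ) →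
  (∀ i → g (f i) ≡ h (toℕ i)) → sum (map g (tabulate f)) ≡ ∑ K h
sum-map-tabulate zero    f g h eq = refl
sum-map-tabulate (suc K) f g h eq =
  trans (cong₂ _+_ (eq fzero) (sum-map-tabulate K (f ∘ fsuc) g (h ∘ suc) (eq ∘ fsuc))) (sym (∑-unfoldˡ K h))

lists : ℕ → ℕ → List (List ℕ)
lists K zero    = [] ∷ []
lists K (suc L) = concatMap (λ a → map (a ∷_) (lists K L)) (upTo K)

count-lists : ∀ K L (p : List ℕ → Bool) → count p (lists K (suc L)) ≡ ∑ K (λ a → count (λ w → p (a ∷ w)) (lists K L))
count-lists K L p = begin
  count p (lists K (suc L))                                    ≡⟨ count-concatMap p _ (upTo K) ⟩
  sum (map (λ a → count p (map (a ∷_) (lists K L))) (upTo K)) ≡⟨ sum-map-upTo K _ ⟩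
  ∑ K (λ a → count p (map (a ∷_) (lists K L)))                ≡⟨ ∑-cong K (λ a → count-map p (a ∷_) (lists K L)) ⟩
  ∑ K (λ a → count (λ w → p (a ∷ w)) (lists K L))             ∎
  where open ≡-Reasoning

count-words : ∀ K L (q : List ℕ → Bool) →
  count (λ (v : Vec (Fin K) L) → q (map toℕ (toList v))) (words K L) ≡ count q (lists K L)
count-words K zero    q = trans (count-∷ (λ v → q (map toℕ (toList v))) []ᵛ []) (sym (count-∷ q [] []))
count-words K (suc L) q = begin
  count (λ v → q (map toℕ (toList v))) (words K (suc L))
    ≡⟨ count-concatMap _ _ (allFin K) ⟩
  sum (map (λ a → count (λ v → q (map toℕ (toList v))) (map (a ∷ᵛ_) (words K L))) (allFin K))
    ≡⟨ sum-map-tabulate K (λ i → i) _ (λ a → count (λ w → q (a ∷ w)) (lists K L))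
         (λ i → trans (count-map _ (i ∷ᵛ_) (words K L)) (count-words K L (λ w → q (toℕ i ∷ w)))) ⟩
  ∑ K (λ a → count (λ w → q (a ∷ w)) (lists K L))
    ≡⟨ sym (count-lists K L q) ⟩
  count q (lists K (suc L)) ∎
  where open ≡-Reasoning

count-perms : ∀ n (q : List ℕ → Bool) → count (λ π → q (word π)) (perms n) ≡ count (λ l → distinct l ∧ q l) (lists n n)
count-perms n q = trans (count-filterᵇ _ _ (words n n)) (count-words n n (λ l → distinct l ∧ q l))

count-lists-cong : ∀ K L {p q : List ℕ → Bool} →
  (∀ w → length w ≡ L → all (_<ᵇ K) w ≡ true → p w ≡ q w) → count p (lists K L) ≡ count q (lists K L)
count-lists-cong K zero {p} {q} p≗q =
  trans (count-∷ p [] []) (trans (cong (λ b → 𝟙 b + 0) (p≗q [] refl refl)) (sym (count-∷ q [] [])))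
count-lists-cong K (suc L) {p} {q} p≗q = begin
  count p (lists K (suc L))                        ≡⟨ count-lists K L p ⟩
  ∑ K (λ a → count (λ w → p (a ∷ w)) (lists K L)) ≡⟨ ∑-cong< K (λ a a<K → count-lists-cong K L (λ w len all<K →
                                                        p≗q (a ∷ w) (cong suc len) (cong₂ _∧_ (<ᵇ-true a<K) all<K))) ⟩
  ∑ K (λ a → count (λ w → q (a ∷ w)) (lists K L)) ≡⟨ sym (count-lists K L q) ⟩
  count q (lists K (suc L))                        ∎
  where open ≡-Reasoning

count-by-value : ∀ K (P : ℕ → Bool) l → all (_<ᵇ K) l ≡ true →
  count P l ≡ ∑ K (λ v → 𝟙 (P v) * count (_≡ᵇ v) l)
count-by-value K P []       _     = sym (∑-zero K (λ v _ → *-zeroʳ (𝟙 (P v))))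
count-by-value K P (x ∷ xs) all<K = begin
  count P (x ∷ xs)
    ≡⟨ count-∷ P x xs ⟩
  𝟙 (P x) + count P xs
    ≡⟨ cong₂ _+_ (sym at-x) (count-by-value K P xs (proj₂ (∧-true all<K))) ⟩
  ∑ K (λ v → 𝟙 (P v) * 𝟙 (x ≡ᵇ v)) + ∑ K (λ v → 𝟙 (P v) * count (_≡ᵇ v) xs)
    ≡⟨ sym (∑-+ K _ _) ⟩
  ∑ K (λ v → 𝟙 (P v) * 𝟙 (x ≡ᵇ v) + 𝟙 (P v) * count (_≡ᵇ v) xs)
    ≡⟨ ∑-cong K (λ v → trans (sym (*-distribˡ-+ (𝟙 (P v)) _ _)) (cong (𝟙 (P v) *_) (sym (count-∷ (_≡ᵇ v) x xs)))) ⟩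
  ∑ K (λ v → 𝟙 (P v) * count (_≡ᵇ v) (x ∷ xs)) ∎
  where
  open ≡-Reasoning
  at-x : ∑ K (λ v → 𝟙 (P v) * 𝟙 (x ≡ᵇ v)) ≡ 𝟙 (P x)
  at-x = trans (∑-single K x _ (<ᵇ-sound (proj₁ (∧-true all<K)))
                  (λ i _ i≢x → trans (cong (λ b → 𝟙 (P i) * 𝟙 b) (≡ᵇ-false (i≢x ∘ sym))) (*-zeroʳ (𝟙 (P i)))))
               (trans (cong (λ b → 𝟙 (P x) * 𝟙 b) (≡ᵇ-refl x)) (*-identityʳ (𝟙 (P x))))

multiplicity-≤ : ∀ (S : ℕ → Bool) l v → distinct l ≡ true → all S l ≡ true → count (_≡ᵇ v) l ≤ 𝟙 (S v)
multiplicity-≤ S []       v _    _    = z≤n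
multiplicity-≤ S (x ∷ xs) v dist allS
  with ∧-true {count (x ≡ᵇ_) xs ≡ᵇ 0} dist | ∧-true {S x} allS
... | fresh , dist′ | Sx , allS′ rewrite count-∷ (_≡ᵇ v) x xs with x ≡ᵇ v in x≡v
...   | false = multiplicity-≤ S xs v dist′ allS′
...   | true rewrite subst (λ u → S u ≡ true) (≡ᵇ-sound x≡v) Sx =
  s≤s (≤-reflexive (trans (count-cong xs (λ y → trans (≡ᵇ-sym y v) (cong (λ u → u ≡ᵇ y) (sym (≡ᵇ-sound {x} {v} x≡v))))) (≡ᵇ-sound fresh)))

all-bounded : ∀ (S : ℕ → Bool) K l → (∀ x → S x ≡ true → x < K) → all S l ≡ true → all (_<ᵇ K) l ≡ true
all-bounded S K []       _      _    = refl
all-bounded S K (x ∷ xs) S⊆[K] allS =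
  cong₂ _∧_ (<ᵇ-true (S⊆[K] x (proj₁ (∧-true allS)))) (all-bounded S K xs S⊆[K] (proj₂ (∧-true {S x} allS)))

rank : (ℕ → Bool) → ℕ → ℕ
rank S y = ∑ y (𝟙 ∘ S)

-- A duplicate-free list of elements of S with |S| entries lists each element of S exactly once.
count-arrangement : ∀ K (S : ℕ → Bool) l (P : ℕ → Bool) → (∀ x → S x ≡ true → x < K) →
  distinct l ≡ true → all S l ≡ true → length l ≡ rank S K → count P l ≡ ∑ K (λ v → 𝟙 (S v ∧ P v))
count-arrangement K S l P S⊆[K] dist allS len =
  trans (count-by-value K P l all<K) (∑-cong< K (λ v v<K → begin
    𝟙 (P v) * count (_≡ᵇ v) l ≡⟨ cong (𝟙 (P v) *_) (once v v<K) ⟩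
    𝟙 (P v) * 𝟙 (S v)         ≡⟨ *-comm (𝟙 (P v)) (𝟙 (S v)) ⟩
    𝟙 (S v) * 𝟙 (P v)         ≡⟨ sym (𝟙-∧ (S v) (P v)) ⟩
    𝟙 (S v ∧ P v)             ∎))
  where
  open ≡-Reasoning
  all<K = all-bounded S K l S⊆[K] allS
  once : ∀ v → v < K → count (_≡ᵇ v) l ≡ 𝟙 (S v)
  once = ∑-pointwise-≡ K (λ v → count (_≡ᵇ v) l) (𝟙 ∘ S) (λ v _ → multiplicity-≤ S l v dist allS) (begin
    ∑ K (λ v → count (_≡ᵇ v) l)              ≡⟨ ∑-cong K (λ v → sym (*-identityˡ _)) ⟩
    ∑ K (λ v → 1 * count (_≡ᵇ v) l)          ≡⟨ sym (count-by-value K (λ _ → true) l all<K) ⟩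
    count (λ _ → true) l                    ≡⟨ count-true l ⟩
    length l                                ≡⟨ len ⟩
    rank S K                                ∎)

rank-mono : ∀ S {x y} → x ≤ y → rank S x ≤ rank S y
rank-mono S {x} {y} x≤y = subst (λ z → rank S x ≤ rank S z) (m+[n∸m]≡n x≤y) (go (y ∸ x))
  where
  go : ∀ d → rank S x ≤ rank S (x + d)
  go zero    = ≤-reflexive (cong (rank S) (sym (+-identityʳ x)))
  go (suc d) = ≤-trans (≤-trans (go d) (m≤m+n _ (𝟙 (S (x + d))))) (≤-reflexive (cong (rank S) (sym (+-suc x d))))

rank-<ᵇ : ∀ S {a} m → S a ≡ true → (a <ᵇ m) ≡ (rank S a <ᵇ rank S m)
rank-<ᵇ S {a} m Sa with a <ᵇ m in a<m
... | true  = sym (<ᵇ-true (≤-trans (≤-reflexive (trans (+-comm 1 (rank S a)) (cong (λ b → rank S a + 𝟙 b) (sym Sa))))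
                                    (rank-mono S {suc a} {m} (<ᵇ-sound a<m))))
... | false = sym (<ᵇ-false (rank-mono S {m} {a} (<ᵇ-false-sound a<m)))

remove : (ℕ → Bool) → ℕ → ℕ → Bool
remove S a x = S x ∧ not (a ≡ᵇ x)

rank-remove-≤ : ∀ S a {y} → y ≤ a → rank (remove S a) y ≡ rank S y
rank-remove-≤ S a {zero}  _     = refl
rank-remove-≤ S a {suc y} y<a = cong₂ _+_ (rank-remove-≤ S a (<⇒≤ y<a))
  (cong 𝟙 (trans (cong (λ b → S y ∧ not b) (≡ᵇ-false (>⇒≢ y<a))) (∧-identityʳ (S y))))

rank-remove-> : ∀ S {a y} → S a ≡ true → a < y → suc (rank (remove S a) y) ≡ rank S y
rank-remove-> S {a} {suc y} Sa (s≤s a≤y) with m≤n⇒m<n∨m≡n a≤y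
... | inj₂ refl = begin
  suc (rank (remove S a) a + 𝟙 (S a ∧ not (a ≡ᵇ a))) ≡⟨ cong₂ (λ r b → suc (r + 𝟙 (S a ∧ not b))) (rank-remove-≤ S a ≤-refl) (≡ᵇ-refl a) ⟩
  suc (rank S a + 𝟙 (S a ∧ false))                    ≡⟨ cong (λ b → suc (rank S a + 𝟙 b)) (∧-zeroʳ (S a)) ⟩
  suc (rank S a + 0)                                  ≡⟨ cong suc (+-identityʳ (rank S a)) ⟩
  suc (rank S a)                                      ≡⟨ +-comm 1 (rank S a) ⟩
  rank S a + 1                                        ≡⟨ cong (λ b → rank S a + 𝟙 b) (sym Sa) ⟩
  rank S a + 𝟙 (S a)                                  ∎
  where open ≡-Reasoning
... | inj₁ a<y = cong₂ _+_ (rank-remove-> S Sa a<y)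
                           (cong 𝟙 (trans (cong (λ b → S y ∧ not b) (≡ᵇ-false (<⇒≢ a<y))) (∧-identityʳ (S y))))

∑-rank : ∀ K (S : ℕ → Bool) (g : ℕ → ℕ) → ∑ K (λ a → if S a then g (rank S a) else 0) ≡ ∑ (rank S K) g
∑-rank zero    S g = refl
∑-rank (suc K) S g with S K
... | true  = trans (cong (_+ g (rank S K)) (∑-rank K S g)) (cong (λ x → ∑ x g) (sym (+-comm (rank S K) 1)))
... | false = trans (trans (+-identityʳ _) (∑-rank K S g)) (cong (λ x → ∑ x g) (sym (+-identityʳ (rank S K))))

rank-<ᵇ-self : ∀ {a n} → a ≤ n → rank (_<ᵇ a) n ≡ a
rank-<ᵇ-self {a} {n} a≤n = trans (∑-extend a n a≤n (λ i a≤i → cong 𝟙 (<ᵇ-false a≤i))) (ones a ≤-refl)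
  where
  ones : ∀ m → m ≤ a → ∑ m (𝟙 ∘ (_<ᵇ a)) ≡ m
  ones zero    _   = refl
  ones (suc m) m<a = trans (cong₂ _+_ (ones m (<⇒≤ m<a)) (cong 𝟙 (<ᵇ-true m<a))) (+-comm m 1)

Perm : ℕ → List ℕ → Set
Perm n l = distinct l ≡ true × all (_<ᵇ n) l ≡ true × length l ≡ n

count-below-perm : ∀ {n l a} → Perm n l → a ≤ n → count (_<ᵇ a) l ≡ a
count-below-perm {n} {l} {a} (dist , all<n , len) a≤n = begin
  count (_<ᵇ a) l                    ≡⟨ count-arrangement n (_<ᵇ n) l (_<ᵇ a) (λ _ → <ᵇ-sound) dist all<n
                                          (trans len (sym (rank-<ᵇ-self ≤-refl))) ⟩
  ∑ n (λ v → 𝟙 ((v <ᵇ n) ∧ (v <ᵇ a))) ≡⟨ ∑-cong< n (λ v v<n → cong (λ b → 𝟙 (b ∧ (v <ᵇ a))) (<ᵇ-true v<n)) ⟩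
  rank (_<ᵇ a) n                     ≡⟨ rank-<ᵇ-self a≤n ⟩
  a                                  ∎
  where open ≡-Reasoning

-- Bi-increasing permutations

-- bound m a is the least value above a and above all letters read before, which were below m.
bound : ℕ → ℕ → ℕ
bound m a = if a <ᵇ m then m else suc a

boundAfter : ℕ → List ℕ → ℕ
boundAfter m []       = m
boundAfter m (x ∷ xs) = boundAfter (bound m x) xs

below : ℕ → List ℕ → ℕ
below a w = count (_<ᵇ a) w

startsBelow : ℕ → List ℕ → Bool
startsBelow a []      = false
startsBelow a (b ∷ _) = b <ᵇ a

-- Every letter is a left-to-right maximum or smaller than all later letters.
maxOrMin : ℕ → List ℕ → Bool
maxOrMin m []      = true
maxOrMin m (a ∷ w) = (if a <ᵇ m then below a w ≡ᵇ 0 else true) ∧ maxOrMin (bound m a) w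

-- Left-to-right maxima with a smaller letter somewhere after them.
jumps : ℕ → List ℕ → ℕ
jumps m []      = 0
jumps m (a ∷ w) = (if a <ᵇ m then 0 else 𝟙 (0 <ᵇ below a w)) + jumps (bound m a) w

-- Those of them that are not followed immediately by a smaller letter.
stalls : ℕ → List ℕ → ℕ
stalls m []      = 0
stalls m (a ∷ w) = (if a <ᵇ m then 0 else 𝟙 ((0 <ᵇ below a w) ∧ not (startsBelow a w))) + stalls (bound m a) w

boundAfter-++ : ∀ m p q → boundAfter m (p ++ q) ≡ boundAfter (boundAfter m p) q
boundAfter-++ m []      q = refl
boundAfter-++ m (x ∷ p) q = boundAfter-++ (bound m x) p q

m≤bound : ∀ m a → m ≤ bound m a
m≤bound m a with a <ᵇ m in a<m
... | true  = ≤-refl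
... | false = m≤n⇒m≤1+n (<ᵇ-false-sound a<m)

a<bound : ∀ m a → a < bound m a
a<bound m a with a <ᵇ m in a<m
... | true  = <ᵇ-sound a<m
... | false = ≤-refl

m≤boundAfter : ∀ m p → m ≤ boundAfter m p
m≤boundAfter m []      = ≤-refl
m≤boundAfter m (x ∷ p) = ≤-trans (m≤bound m x) (m≤boundAfter (bound m x) p)

boundAfter≤⇒all-below : ∀ m p {a} → boundAfter m p ≤ a → below a p ≡ length p
boundAfter≤⇒all-below m []      _    = refl
boundAfter≤⇒all-below m (x ∷ p) {a} ≤a = trans (count-∷ (_<ᵇ a) x p)
  (cong₂ _+_ (cong 𝟙 (<ᵇ-true (<-≤-trans (a<bound m x) (≤-trans (m≤boundAfter (bound m x) p) ≤a))))
             (boundAfter≤⇒all-below (bound m x) p ≤a))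

<boundAfter⇒some-above : ∀ m p {a} → a < boundAfter m p → a < m ⊎ below a p < length p
<boundAfter⇒some-above m []      a<m = inj₁ a<m
<boundAfter⇒some-above m (x ∷ p) {a} a<M with <boundAfter⇒some-above (bound m x) p a<M
... | inj₂ some = inj₂ (s≤s (≤-trans (≤-reflexive (count-∷ (_<ᵇ a) x p)) (≤-trans (+-monoˡ-≤ (below a p) (𝟙≤1 (x <ᵇ a))) some)))
... | inj₁ a<bound with x <ᵇ m in x<m
...   | true  = inj₁ a<bound
...   | false = inj₂ (s≤s (≤-trans (≤-reflexive (trans (count-∷ (_<ᵇ a) x p) (cong (λ b → 𝟙 b + below a p) (<ᵇ-false (≤-pred a<bound)))))
                                  (count-≤-length _ p)))

-- A letter a at position c with cp smaller letters before it and r after it, where M bounds the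
-- letters before it; a is a left-to-right maximum (M ≤ a) exactly when all of them are smaller.
module Letter {a c cp r M : ℕ} (a≡cp+r : a ≡ cp + r) (cp≤c : cp ≤ c)
              (maximum : M ≤ a → cp ≡ c) (not-maximum : a < M → cp < c) where

  a≤c+r : a ≤ c + r
  a≤c+r = subst (_≤ c + r) (sym a≡cp+r) (+-monoˡ-≤ r cp≤c)

  excess≤below : (if c <ᵇ a then a ∸ c else 0) ≤ r
  excess≤below with c <ᵇ a
  ... | true  = m≤n+o⇒m∸n≤o a c a≤c+r
  ... | false = z≤n

  low-letter : a < M → r ≡ 0 → (c <ᵇ a) ≡ false
  low-letter a<M refl = <ᵇ-false (≤-trans (≤-reflexive (trans a≡cp+r (+-identityʳ cp))) (<⇒≤ (not-maximum a<M)))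

  maximum-at : M ≤ a → a ≡ c + r
  maximum-at M≤a = trans a≡cp+r (cong (_+ r) (maximum M≤a))

  excess≡below⇒ : (if c <ᵇ a then a ∸ c else 0) ≡ r → a < M → r ≡ 0
  excess≡below⇒ e a<M with c <ᵇ a in c<a
  ... | false = sym e
  ... | true  = ⊥-elim (<-irrefl (+-cancelʳ-≡ r cp c (begin
    cp + r         ≡⟨ sym a≡cp+r ⟩
    a              ≡⟨ sym (m+[n∸m]≡n (<⇒≤ (<ᵇ-sound c<a))) ⟩
    c + (a ∸ c)    ≡⟨ cong (c +_) e ⟩
    c + r          ∎)) (not-maximum a<M))
    where open ≡-Reasoning

  ⇒excess≡below : (a < M → r ≡ 0) → (if c <ᵇ a then a ∸ c else 0) ≡ r
  ⇒excess≡below min with a <ᵇ M in a<M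
  ... | true rewrite low-letter (<ᵇ-sound a<M) (min (<ᵇ-sound a<M)) = sym (min (<ᵇ-sound a<M))
  ... | false with c <ᵇ a in c<a
  ...   | true  = trans (cong (_∸ c) (maximum-at (<ᵇ-false-sound a<M))) (m+n∸m≡n c r)
  ...   | false = sym (n≤0⇒n≡0 (+-cancelˡ-≤ c r 0
                    (≤-trans (≤-reflexive (sym (maximum-at (<ᵇ-false-sound a<M))))
                             (≤-trans (<ᵇ-false-sound c<a) (≤-reflexive (sym (+-identityʳ c)))))))

  ⇒exceedance : (a < M → r ≡ 0) → 𝟙 (c <ᵇ a) ≡ (if a <ᵇ M then 0 else 𝟙 (0 <ᵇ r))
  ⇒exceedance min with a <ᵇ M in a<M
  ... | true rewrite low-letter (<ᵇ-sound a<M) (min (<ᵇ-sound a<M)) = refl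
  ... | false = exceeds r (maximum-at (<ᵇ-false-sound a<M))
    where
    exceeds : ∀ r → a ≡ c + r → 𝟙 (c <ᵇ a) ≡ 𝟙 (0 <ᵇ r)
    exceeds zero    e rewrite e | +-identityʳ c | <ᵇ-false {c} {c} ≤-refl = refl
    exceeds (suc r) e rewrite e | <ᵇ-true {c} {c + suc r} (m<m+n c z<s) = refl

all-middle : ∀ {P : ℕ → Bool} p a rest → all P (p ++ a ∷ rest) ≡ true → P a ≡ true
all-middle {P} []      a rest allP = proj₁ (∧-true {P a} allP)
all-middle {P} (x ∷ p) a rest allP = all-middle p a rest (proj₂ (∧-true {P x} allP))

below-split : ∀ {n} p a rest → Perm n (p ++ a ∷ rest) → a ≡ below a p + below a rest
below-split p a rest π@(_ , all<n , _) = sym (begin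
  below a p + below a rest                  ≡⟨ cong (λ b → below a p + (𝟙 b + below a rest)) (sym (<ᵇ-false {a} ≤-refl)) ⟩
  below a p + (𝟙 (a <ᵇ a) + below a rest)   ≡⟨ cong (below a p +_) (sym (count-∷ (_<ᵇ a) a rest)) ⟩
  below a p + below a (a ∷ rest)            ≡⟨ sym (count-++ (_<ᵇ a) p (a ∷ rest)) ⟩
  below a (p ++ a ∷ rest)             ≡⟨ count-below-perm {l = p ++ a ∷ rest} π (<⇒≤ (<ᵇ-sound (all-middle p a rest all<n))) ⟩
  a                                   ∎)
  where open ≡-Reasoning

<boundAfter-0⇒some-above : ∀ p {a} → a < boundAfter 0 p → below a p < length p
<boundAfter-0⇒some-above p a<M with <boundAfter⇒some-above 0 p a<M
... | inj₂ some = some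

module LetterOf {n} (p : List ℕ) (a : ℕ) (rest : List ℕ) (π : Perm n (p ++ a ∷ rest)) where

  open Letter (below-split p a rest π) (count-≤-length _ p) (boundAfter≤⇒all-below 0 p)
              (<boundAfter-0⇒some-above p) public

  π′ : Perm n ((p ++ [ a ]) ++ rest)
  π′ = subst (Perm n) (sym (++-assoc p [ a ] rest)) π

  length′ : length (p ++ [ a ]) ≡ suc (length p)
  length′ = trans (length-++ p) (+-comm (length p) 1)

  bound′ : boundAfter 0 (p ++ [ a ]) ≡ bound (boundAfter 0 p) a
  bound′ = boundAfter-++ 0 p [ a ]

minimum-condition : ∀ a M r → (a < M → r ≡ 0) → (if a <ᵇ M then r ≡ᵇ 0 else true) ≡ true
minimum-condition a M r min with a <ᵇ M in a<M
... | true  = subst (λ x → (r ≡ᵇ x) ≡ true) (min (<ᵇ-sound a<M)) (≡ᵇ-refl r)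
... | false = refl

minimum-condition⁻¹ : ∀ a M r → (if a <ᵇ M then r ≡ᵇ 0 else true) ≡ true → a < M → r ≡ 0
minimum-condition⁻¹ a M r cond a<M rewrite <ᵇ-true a<M = ≡ᵇ-sound cond

dexc≤inv : ∀ {n} p w → Perm n (p ++ w) → dexcFrom (length p) w ≤ inv w
dexc≤inv p []         _ = z≤n
dexc≤inv p (a ∷ rest) π = +-mono-≤ excess≤below
  (subst (λ c → dexcFrom c rest ≤ inv rest) length′ (dexc≤inv (p ++ [ a ]) rest π′))
  where open LetterOf p a rest π

inv≡dexc⇒maxOrMin : ∀ {n} p w → Perm n (p ++ w) → inv w ≡ dexcFrom (length p) w → maxOrMin (boundAfter 0 p) w ≡ true
inv≡dexc⇒maxOrMin p []         _ _ = refl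
inv≡dexc⇒maxOrMin p (a ∷ rest) π e
  with +-≤-equality excess≤below (subst (λ c → dexcFrom c rest ≤ inv rest) length′ (dexc≤inv (p ++ [ a ]) rest π′)) (sym e)
  where open LetterOf p a rest π
... | here , later = cong₂ _∧_ (minimum-condition a (boundAfter 0 p) (below a rest) (excess≡below⇒ here))
  (subst (λ m → maxOrMin m rest ≡ true) bound′
    (inv≡dexc⇒maxOrMin (p ++ [ a ]) rest π′ (trans (sym later) (cong (λ c → dexcFrom c rest) (sym length′)))))
  where open LetterOf p a rest π

maxOrMin⇒inv≡dexc : ∀ {n} p w → Perm n (p ++ w) → maxOrMin (boundAfter 0 p) w ≡ true → inv w ≡ dexcFrom (length p) w
maxOrMin⇒inv≡dexc p []         _ _ = refl
maxOrMin⇒inv≡dexc p (a ∷ rest) π mm with ∧-true {if a <ᵇ boundAfter 0 p then below a rest ≡ᵇ 0 else true} mm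
... | here , later = cong₂ _+_
  (sym (⇒excess≡below (minimum-condition⁻¹ a (boundAfter 0 p) (below a rest) here)))
  (trans (maxOrMin⇒inv≡dexc (p ++ [ a ]) rest π′ (subst (λ m → maxOrMin m rest ≡ true) (sym bound′) later))
         (cong (λ c → dexcFrom c rest) length′))
  where open LetterOf p a rest π

maxOrMin⇒exc≡jumps : ∀ {n} p w → Perm n (p ++ w) → maxOrMin (boundAfter 0 p) w ≡ true →
  excFrom (length p) w ≡ jumps (boundAfter 0 p) w
maxOrMin⇒exc≡jumps p []         _ _ = refl
maxOrMin⇒exc≡jumps p (a ∷ rest) π mm with ∧-true {if a <ᵇ boundAfter 0 p then below a rest ≡ᵇ 0 else true} mm
... | here , later = cong₂ _+_
  (⇒exceedance (minimum-condition⁻¹ a (boundAfter 0 p) (below a rest) here))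
  (trans (cong (λ c → excFrom c rest) (sym length′))
    (trans (maxOrMin⇒exc≡jumps (p ++ [ a ]) rest π′ (subst (λ m → maxOrMin m rest ≡ true) (sym bound′) later))
           (cong (λ m → jumps m rest) bound′)))
  where open LetterOf p a rest π

des-∷ : ∀ a w → des (a ∷ w) ≡ 𝟙 (startsBelow a w) + des w
des-∷ a []      = refl
des-∷ a (b ∷ w) = refl

startsBelow⇒below : ∀ a w → startsBelow a w ≡ true → 0 < below a w
startsBelow⇒below a (b ∷ w) b<a = subst (0 <_) (sym (trans (count-∷ (_<ᵇ a) b w) (cong (λ x → 𝟙 x + below a w) b<a))) z<s

-- A left-to-right maximum with smaller letters after it either starts a descent or stalls.
jump-split : ∀ a m w → (if a <ᵇ m then below a w ≡ᵇ 0 else true) ≡ true →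
  (if a <ᵇ m then 0 else 𝟙 (0 <ᵇ below a w))
    ≡ 𝟙 (startsBelow a w) + (if a <ᵇ m then 0 else 𝟙 ((0 <ᵇ below a w) ∧ not (startsBelow a w)))
jump-split a m w cond with a <ᵇ m | startsBelow a w in descent
... | true  | false = refl
... | true  | true  = ⊥-elim (<-irrefl (sym (≡ᵇ-sound cond)) (startsBelow⇒below a w descent))
... | false | true  rewrite <ᵇ-true (startsBelow⇒below a w descent) = refl
... | false | false with 0 <ᵇ below a w
...   | true  = refl
...   | false = refl

maxOrMin⇒jumps≡des+stalls : ∀ m w → maxOrMin m w ≡ true → jumps m w ≡ des w + stalls m w
maxOrMin⇒jumps≡des+stalls m []      _  = refl
maxOrMin⇒jumps≡des+stalls m (a ∷ w) mm with ∧-true {if a <ᵇ m then below a w ≡ᵇ 0 else true} mm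
... | here , later = begin
  Jm + jumps (bound m a) w                          ≡⟨ cong₂ _+_ (jump-split a m w here) (maxOrMin⇒jumps≡des+stalls (bound m a) w later) ⟩
  (D + S) + (des w + stalls (bound m a) w)          ≡⟨ +-+-swap D S (des w) _ ⟩
  (D + des w) + (S + stalls (bound m a) w)          ≡⟨ cong (_+ (S + stalls (bound m a) w)) (sym (des-∷ a w)) ⟩
  des (a ∷ w) + stalls m (a ∷ w)                    ∎
  where
  open ≡-Reasoning
  Jm = if a <ᵇ m then 0 else 𝟙 (0 <ᵇ below a w)
  D = 𝟙 (startsBelow a w)
  S = if a <ᵇ m then 0 else 𝟙 ((0 <ᵇ below a w) ∧ not (startsBelow a w))

-- The automaton recognising good permutations with a given number of descents

whenSuc : ∀ {A : Set} → A → (ℕ → A) → ℕ → A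
whenSuc z g zero    = z
whenSuc z g (suc k) = g k

-- State: the bound m of the letters read, whether the last letter is a left-to-right maximum
-- that must start a descent (f), and the number k of jumps still to come.
accepts : ℕ → Bool → ℕ → List ℕ → Bool
accepts m f k []      = not f ∧ (k ≡ᵇ 0)
accepts m f k (a ∷ w) =
  if a <ᵇ m then (below a w ≡ᵇ 0) ∧ accepts m false k w
  else not f ∧ (if 0 <ᵇ below a w then whenSuc false (λ k′ → accepts (suc a) true k′ w) k
                else accepts (suc a) false k w)

startsBelow-suc : ∀ a w → (count (a ≡ᵇ_) w ≡ᵇ 0) ≡ true → startsBelow (suc a) w ≡ startsBelow a w
startsBelow-suc a []      _     = refl
startsBelow-suc a (b ∷ w) fresh = <ᵇ-suc b≢a
  where
  b≢a : b ≢ a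
  b≢a refl = 0≢1+n (trans (sym (≡ᵇ-sound fresh))
                          (trans (count-∷ (a ≡ᵇ_) a w) (cong (λ x → 𝟙 x + count (a ≡ᵇ_) w) (≡ᵇ-refl a))))

accepts-spec : ∀ m f k w → distinct w ≡ true →
  accepts m f k w ≡ (((maxOrMin m w ∧ (stalls m w ≡ᵇ 0)) ∧ (if f then startsBelow m w else true)) ∧ (jumps m w ≡ᵇ k))
accepts-spec m false k []      _    = ≡ᵇ-sym k 0
accepts-spec m true  k []      _    = refl
accepts-spec m f     k (a ∷ w) dist with ∧-true {count (a ≡ᵇ_) w ≡ᵇ 0} dist
... | fresh , dist′ with a <ᵇ m
...   | true rewrite accepts-spec m false k w dist′ with f | below a w ≡ᵇ 0
...     | true  | true  = refl
...     | true  | false = refl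
...     | false | true  = refl
...     | false | false = refl
accepts-spec m f k (a ∷ w) dist | fresh , dist′ | false with 0 <ᵇ below a w
...   | false rewrite accepts-spec (suc a) false k w dist′ with f
...     | true  = sym (cong (_∧ (jumps (suc a) w ≡ᵇ k)) (∧-zeroʳ _))
...     | false = refl
accepts-spec m f zero     (a ∷ w) dist | fresh , dist′ | false | true = trans (∧-zeroʳ (not f)) (sym (∧-zeroʳ _))
accepts-spec m f (suc k′) (a ∷ w) dist | fresh , dist′ | false | true
  rewrite accepts-spec (suc a) true k′ w dist′ | startsBelow-suc a w fresh with f
...   | true  = sym (cong (_∧ (jumps (suc a) w ≡ᵇ k′)) (∧-zeroʳ _))
...   | false with startsBelow a w
...     | true  = refl
...     | false = cong (_∧ (jumps (suc a) w ≡ᵇ k′)) (trans (∧-zeroʳ _) (sym (cong (_∧ true) (∧-zeroʳ (maxOrMin (suc a) w)))))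

stalls-free : ∀ d s k → ((d + s ≡ᵇ d) ∧ (d ≡ᵇ k)) ≡ (((s ≡ᵇ 0) ∧ true) ∧ (d + s ≡ᵇ k))
stalls-free d zero    k rewrite +-identityʳ d | ≡ᵇ-refl d = refl
stalls-free d (suc s) k rewrite ≡ᵇ-false (m+1+n≢m d {s}) = refl

-- Bi-increasing means left-to-right maxima or right-to-left minima only, and then
-- exc = des says that every maximum with a smaller letter after it starts a descent.
good∧des≡accepts : ∀ {n l} k → Perm n l → (good l ∧ (des l ≡ᵇ k)) ≡ accepts 0 false k l
good∧des≡accepts {n} {l} k π@(dist , _) rewrite accepts-spec 0 false k l dist with maxOrMin 0 l in mm
... | true rewrite maxOrMin⇒inv≡dexc [] l π mm | ≡ᵇ-refl (dexc l) | maxOrMin⇒exc≡jumps [] l π mm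
                 | maxOrMin⇒jumps≡des+stalls 0 l mm = stalls-free (des l) (stalls 0 l) k
... | false with inv l ≡ᵇ dexc l in inv≡dexc
...   | true  = case trans (sym mm) (inv≡dexc⇒maxOrMin [] l π (≡ᵇ-sound inv≡dexc)) of λ ()
...   | false = refl

distinctIn : (ℕ → Bool) → List ℕ → Bool
distinctIn S w = distinct w ∧ all S w

all-remove : ∀ S a w → ((count (a ≡ᵇ_) w ≡ᵇ 0) ∧ all S w) ≡ all (remove S a) w
all-remove S a []      = refl
all-remove S a (x ∷ w) rewrite count-∷ (a ≡ᵇ_) x w with a ≡ᵇ x | S x
... | true  | true  = refl
... | true  | false = refl
... | false | true  = all-remove S a w
... | false | false = ∧-zeroʳ (count (a ≡ᵇ_) w ≡ᵇ 0)

distinctIn-∷ : ∀ S a w → distinctIn S (a ∷ w) ≡ S a ∧ distinctIn (remove S a) w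
distinctIn-∷ S a w rewrite sym (all-remove S a w) with count (a ≡ᵇ_) w ≡ᵇ 0 | S a
... | true  | true  = refl
... | true  | false = ∧-zeroʳ (distinct w)
... | false | true  = sym (∧-zeroʳ (distinct w))
... | false | false = refl

-- The transfer recursion: t letters lie below the bound, and b is the rank of the first letter.
firstLetter : (ℕ → Bool → ℕ → ℕ) → ℕ → Bool → ℕ → ℕ → ℕ
firstLetter N t f k b =
  if b <ᵇ t then (if b ≡ᵇ 0 then N (t ∸ 1) false k else 0)
  else (if f then 0 else (if 0 <ᵇ b then whenSuc 0 (N b true) k else N b false k))

transfer : ℕ → ℕ → Bool → ℕ → ℕ
transfer zero    t f k = 𝟙 (not f ∧ (k ≡ᵇ 0))
transfer (suc L) t f k = ∑ (suc L) (firstLetter (transfer L) t f k)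

acceptsAfter : ℕ → Bool → ℕ → ℕ → ℕ → List ℕ → Bool
acceptsAfter m f k a r w =
  if a <ᵇ m then (r ≡ᵇ 0) ∧ accepts m false k w
  else not f ∧ (if 0 <ᵇ r then whenSuc false (λ k′ → accepts (suc a) true k′ w) k else accepts (suc a) false k w)

accepts-∷ : ∀ m f k a w {r} → below a w ≡ r → accepts m f k (a ∷ w) ≡ acceptsAfter m f k a r w
accepts-∷ m f k a w refl = refl

module FirstLetter (K L : ℕ)
  (count-rest : ∀ S m f k → (∀ x → S x ≡ true → x < K) → rank S K ≡ L →
                count (λ w → distinctIn S w ∧ accepts m f k w) (lists K L) ≡ transfer L (rank S m) f k)
  (S : ℕ → Bool) (S⊆[K] : ∀ x → S x ≡ true → x < K) (|S| : rank S K ≡ suc L) where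

  module _ {a : ℕ} (a<K : a < K) (Sa : S a ≡ true) where

    S∖a⊆[K] : ∀ x → remove S a x ≡ true → x < K
    S∖a⊆[K] x e = S⊆[K] x (proj₁ (∧-true {S x} e))

    |S∖a| : rank (remove S a) K ≡ L
    |S∖a| = suc-injective (trans (rank-remove-> S Sa a<K) |S|)

    rank-remove-suc : rank (remove S a) (suc a) ≡ rank S a
    rank-remove-suc = suc-injective (trans (rank-remove-> S Sa ≤-refl)
                                           (trans (cong (λ b → rank S a + 𝟙 b) Sa) (+-comm (rank S a) 1)))

    -- The rest of an arrangement of S lists S ∖ {a}, so exactly rank S a of its letters lie below a.
    below-rest : ∀ w → length w ≡ L → distinctIn (remove S a) w ≡ true → below a w ≡ rank S a
    below-rest w len arr = begin
      below a w
        ≡⟨ count-arrangement K (remove S a) w (_<ᵇ a) S∖a⊆[K] (proj₁ (∧-true arr)) (proj₂ (∧-true arr)) (trans len (sym |S∖a|)) ⟩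
      ∑ K (λ v → 𝟙 (remove S a v ∧ (v <ᵇ a)))
        ≡⟨ ∑-extend a K (<⇒≤ a<K) (λ v a≤v → cong 𝟙 (trans (cong (remove S a v ∧_) (<ᵇ-false a≤v)) (∧-zeroʳ _))) ⟩
      ∑ a (λ v → 𝟙 (remove S a v ∧ (v <ᵇ a)))
        ≡⟨ ∑-cong< a (λ v v<a → cong 𝟙 (trans (cong (remove S a v ∧_) (<ᵇ-true v<a)) (∧-identityʳ _))) ⟩
      rank (remove S a) a
        ≡⟨ rank-remove-≤ S a ≤-refl ⟩
      rank S a ∎
      where open ≡-Reasoning

    count-after : ∀ m f k →
      count (λ w → distinctIn (remove S a) w ∧ acceptsAfter m f k a (rank S a) w) (lists K L)
        ≡ firstLetter (transfer L) (rank S m) f k (rank S a)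
    count-after m f k rewrite sym (rank-<ᵇ S m Sa) with a <ᵇ m in a<m
    ... | true = begin
      count (λ w → D w ∧ ((r ≡ᵇ 0) ∧ accepts m false k w)) (lists K L)
        ≡⟨ count-cong (lists K L) (λ w → ∧-swapˡ (D w) (r ≡ᵇ 0) _) ⟩
      count (λ w → (r ≡ᵇ 0) ∧ (D w ∧ accepts m false k w)) (lists K L)
        ≡⟨ count-guard (r ≡ᵇ 0) _ (lists K L) ⟩
      (if r ≡ᵇ 0 then count (λ w → D w ∧ accepts m false k w) (lists K L) else 0)
        ≡⟨ cong (λ x → if r ≡ᵇ 0 then x else 0) (count-rest (remove S a) m false k S∖a⊆[K] |S∖a|) ⟩
      (if r ≡ᵇ 0 then transfer L (rank (remove S a) m) false k else 0)
        ≡⟨ cong (λ t → if r ≡ᵇ 0 then transfer L t false k else 0)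
                (cong (_∸ 1) (rank-remove-> S {y = m} Sa (<ᵇ-sound a<m))) ⟩
      (if r ≡ᵇ 0 then transfer L (rank S m ∸ 1) false k else 0) ∎
      where
      open ≡-Reasoning
      r = rank S a
      D = distinctIn (remove S a)
    ... | false = trans (count-cong (lists K L) (λ w → ∧-swapˡ (distinctIn (remove S a) w) (not f) _))
                        (trans (count-guard (not f) _ (lists K L)) (max-letter f))
      where
      r = rank S a
      D = distinctIn (remove S a)
      rest : ∀ f′ k′ → count (λ w → D w ∧ accepts (suc a) f′ k′ w) (lists K L) ≡ transfer L r f′ k′
      rest f′ k′ = trans (count-rest (remove S a) (suc a) f′ k′ S∖a⊆[K] |S∖a|) (cong (λ t → transfer L t f′ k′) rank-remove-suc)
      max-letter : ∀ f →
        (if not f then count (λ w → D w ∧ (if 0 <ᵇ r then whenSuc false (λ k′ → accepts (suc a) true k′ w) k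
                                             else accepts (suc a) false k w)) (lists K L) else 0)
          ≡ (if f then 0 else (if 0 <ᵇ r then whenSuc 0 (transfer L r true) k else transfer L r false k))
      max-letter true  = refl
      max-letter false with 0 <ᵇ r
      ... | false = rest false k
      ... | true  = jump k
        where
        jump : ∀ k → count (λ w → D w ∧ whenSuc false (λ k′ → accepts (suc a) true k′ w) k) (lists K L)
                       ≡ whenSuc 0 (transfer L r true) k
        jump zero     = trans (count-cong (lists K L) (λ w → ∧-zeroʳ (D w))) (count-false (lists K L))
        jump (suc k′) = rest true k′

  count-first : ∀ m f k {a} → a < K →
    count (λ w → distinctIn S (a ∷ w) ∧ accepts m f k (a ∷ w)) (lists K L)
      ≡ (if S a then firstLetter (transfer L) (rank S m) f k (rank S a) else 0)
  count-first m f k {a} a<K =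
    trans (count-cong (lists K L) (λ w → trans (cong (_∧ accepts m f k (a ∷ w)) (distinctIn-∷ S a w)) (∧-assoc (S a) _ _)))
          (trans (count-guard (S a) _ (lists K L)) (present (S a) refl))
    where
    present : ∀ b → S a ≡ b →
      (if b then count (λ w → distinctIn (remove S a) w ∧ accepts m f k (a ∷ w)) (lists K L) else 0)
        ≡ (if b then firstLetter (transfer L) (rank S m) f k (rank S a) else 0)
    present false _  = refl
    present true  Sa = trans (count-lists-cong K L (λ w len _ → ∧-guard (distinctIn (remove S a) w)
                                (λ arr → accepts-∷ m f k a w (below-rest a<K Sa w len arr))))
                             (count-after a<K Sa m f k)

count-accepted : ∀ K L S m f k → (∀ x → S x ≡ true → x < K) → rank S K ≡ L →
  count (λ w → distinctIn S w ∧ accepts m f k w) (lists K L) ≡ transfer L (rank S m) f k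
count-accepted K zero    S m f k _     _   =
  trans (count-∷ (λ w → distinctIn S w ∧ accepts m f k w) [] []) (+-identityʳ _)
count-accepted K (suc L) S m f k S⊆[K] |S| = begin
  count (λ w → distinctIn S w ∧ accepts m f k w) (lists K (suc L))
    ≡⟨ count-lists K L _ ⟩
  ∑ K (λ a → count (λ w → distinctIn S (a ∷ w) ∧ accepts m f k (a ∷ w)) (lists K L))
    ≡⟨ ∑-cong< K (λ a → count-first m f k) ⟩
  ∑ K (λ a → if S a then firstLetter (transfer L) (rank S m) f k (rank S a) else 0)
    ≡⟨ ∑-rank K S _ ⟩
  ∑ (rank S K) (firstLetter (transfer L) (rank S m) f k)
    ≡⟨ cong (λ n → ∑ n (firstLetter (transfer L) (rank S m) f k)) |S| ⟩
  transfer (suc L) (rank S m) f k ∎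
  where
  open ≡-Reasoning
  open FirstLetter K L (λ S′ m′ f′ k′ → count-accepted K L S′ m′ f′ k′) S S⊆[K] |S|

-- After a jump the next letter must be the smallest one left.
transfer-jump : ∀ L b k → transfer (suc L) (suc b) true k ≡ transfer L b false k
transfer-jump L b k =
  trans (∑-unfoldˡ L (firstLetter (transfer L) (suc b) true k))
        (trans (cong (transfer L b false k +_) (∑-zero L (λ i _ → later i))) (+-identityʳ _))
  where
  later : ∀ i → firstLetter (transfer L) (suc b) true k (suc i) ≡ 0
  later i with suc i <ᵇ suc b
  ... | true  = refl
  ... | false = refl

firstLetter-0 : ∀ N t k → firstLetter N t false k 0 ≡ N (t ∸ 1) false k
firstLetter-0 N zero    k = refl
firstLetter-0 N (suc t) k = refl

firstLetter-suc : ∀ N t k b → firstLetter N t false k (suc b) ≡ 𝟙 (t ∸ 1 ≤ᵇ b) * whenSuc 0 (N (suc b) true) k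
firstLetter-suc N zero    k b = sym (+-identityʳ _)
firstLetter-suc N (suc t) k b with b <ᵇ t in b<t
... | true  = cong (λ x → 𝟙 x * whenSuc 0 (N (suc b) true) k) (sym (≤ᵇ-false {t} {b} (<ᵇ-sound b<t)))
... | false = trans (sym (+-identityʳ _)) (cong (λ x → 𝟙 x * whenSuc 0 (N (suc b) true) k) (sym (≤ᵇ-true {t} {b} (<ᵇ-false-sound b<t))))

transfer≡tails : ∀ L t k → t ≤ L → transfer L t false k ≡ tails L t k
transfer≡tails zero          zero zero    _   = refl
transfer≡tails zero          zero (suc k) _   = refl
transfer≡tails (suc zero)    t    k       t≤1 =
  trans (firstLetter-0 (transfer 0) t k) (transfer≡tails 0 (t ∸ 1) k (∸-monoˡ-≤ 1 t≤1))
transfer≡tails (suc (suc L)) t    k       t≤  = begin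
  ∑ (suc (suc L)) (firstLetter (transfer (suc L)) t false k)
    ≡⟨ ∑-unfoldˡ (suc L) _ ⟩
  firstLetter (transfer (suc L)) t false k 0 + ∑ (suc L) (λ b → firstLetter (transfer (suc L)) t false k (suc b))
    ≡⟨ cong₂ _+_ (trans (firstLetter-0 (transfer (suc L)) t k) (transfer≡tails (suc L) (t ∸ 1) k (∸-monoˡ-≤ 1 t≤)))
                 (∑-cong (suc L) (firstLetter-suc (transfer (suc L)) t k)) ⟩
  tails (suc L) (t ∸ 1) k + ∑ (suc L) (λ b → 𝟙 (t ∸ 1 ≤ᵇ b) * whenSuc 0 (transfer (suc L) (suc b) true) k)
    ≡⟨ jumps-first k ⟩
  tails (suc (suc L)) t k ∎
  where
  open ≡-Reasoning
  jumps-first : ∀ k → tails (suc L) (t ∸ 1) k + ∑ (suc L) (λ b → 𝟙 (t ∸ 1 ≤ᵇ b) * whenSuc 0 (transfer (suc L) (suc b) true) k)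
                      ≡ tails (suc (suc L)) t k
  jumps-first zero     = trans (cong (tails (suc L) (t ∸ 1) zero +_) (∑-zero (suc L) (λ b _ → *-zeroʳ (𝟙 (t ∸ 1 ≤ᵇ b)))))
                               (+-identityʳ _)
  jumps-first (suc k′) = cong (tails (suc L) (t ∸ 1) (suc k′) +_) (∑-cong< (suc L) (λ b b≤L →
    cong (𝟙 (t ∸ 1 ≤ᵇ b) *_) (trans (transfer-jump L b k′) (transfer≡tails L b k′ (≤-pred b≤L)))))

count-by-level : ∀ {A : Set} N (p : A → Bool) (g : A → ℕ) xs → (∀ x → p x ≡ true → g x < N) →
  count p xs ≡ ∑ N (λ k → count (λ x → p x ∧ (g x ≡ᵇ k)) xs)
count-by-level N p g []       _   = sym (∑-zero N (λ _ _ → refl))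
count-by-level N p g (x ∷ xs) g<N = begin
  count p (x ∷ xs)
    ≡⟨ count-∷ p x xs ⟩
  𝟙 (p x) + count p xs
    ≡⟨ cong₂ _+_ (sym (level (p x) refl)) (count-by-level N p g xs g<N) ⟩
  ∑ N (λ k → 𝟙 (p x ∧ (g x ≡ᵇ k))) + ∑ N (λ k → count (λ y → p y ∧ (g y ≡ᵇ k)) xs)
    ≡⟨ sym (∑-+ N _ _) ⟩
  ∑ N (λ k → 𝟙 (p x ∧ (g x ≡ᵇ k)) + count (λ y → p y ∧ (g y ≡ᵇ k)) xs)
    ≡⟨ ∑-cong N (λ k → sym (count-∷ (λ y → p y ∧ (g y ≡ᵇ k)) x xs)) ⟩
  ∑ N (λ k → count (λ y → p y ∧ (g y ≡ᵇ k)) (x ∷ xs)) ∎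
  where
  open ≡-Reasoning
  level : ∀ b → p x ≡ b → ∑ N (λ k → 𝟙 (p x ∧ (g x ≡ᵇ k))) ≡ 𝟙 b
  level false px = ∑-zero N (λ k _ → cong (λ c → 𝟙 (c ∧ (g x ≡ᵇ k))) px)
  level true  px = begin
    ∑ N (λ k → 𝟙 (p x ∧ (g x ≡ᵇ k))) ≡⟨ ∑-cong N (λ k → cong (λ c → 𝟙 (c ∧ (g x ≡ᵇ k))) px) ⟩
    ∑ N (λ k → 𝟙 (g x ≡ᵇ k))         ≡⟨ ∑-single N (g x) _ (g<N x px) (λ k _ k≢gx → cong 𝟙 (≡ᵇ-false (k≢gx ∘ sym))) ⟩
    𝟙 (g x ≡ᵇ g x)                   ≡⟨ cong 𝟙 (≡ᵇ-refl (g x)) ⟩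
    1                                ∎

des≤length : ∀ w → des w ≤ length w
des≤length []      = z≤n
des≤length (a ∷ w) = ≤-trans (≤-reflexive (des-∷ a w)) (+-mono-≤ (𝟙≤1 (startsBelow a w)) (des≤length w))

des-word≤ : ∀ {n} (π : Vec (Fin n) n) → des (word π) ≤ n
des-word≤ π = ≤-trans (des≤length (word π)) (≤-reflexive (trans (length-map toℕ (toList π)) (length-toList π)))

count-good-with-descents : ∀ n k → count (λ π → good (word π) ∧ (des (word π) ≡ᵇ k)) (perms n) ≡ motzkinTri n k
count-good-with-descents n k = begin
  count (λ π → good (word π) ∧ (des (word π) ≡ᵇ k)) (perms n)
    ≡⟨ count-perms n (λ l → good l ∧ (des l ≡ᵇ k)) ⟩
  count (λ l → distinct l ∧ (good l ∧ (des l ≡ᵇ k))) (lists n n)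
    ≡⟨ count-lists-cong n n as-automaton ⟩
  count (λ w → distinctIn (_<ᵇ n) w ∧ accepts 0 false k w) (lists n n)
    ≡⟨ count-accepted n n (_<ᵇ n) 0 false k (λ _ → <ᵇ-sound) (rank-<ᵇ-self ≤-refl) ⟩
  transfer n 0 false k
    ≡⟨ transfer≡tails n 0 k z≤n ⟩
  tails₀ n k
    ≡⟨ tails₀≡motzkinTri n k ⟩
  motzkinTri n k ∎
  where
  open ≡-Reasoning
  as-automaton : ∀ w → length w ≡ n → all (_<ᵇ n) w ≡ true →
    (distinct w ∧ (good w ∧ (des w ≡ᵇ k))) ≡ (distinctIn (_<ᵇ n) w ∧ accepts 0 false k w)
  as-automaton w len all<n with distinct w in dist
  ... | false = refl
  ... | true rewrite all<n = good∧des≡accepts {l = w} k (dist , all<n , len)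

corollary4p6 : (n : ℕ) →
    (count (λ π → good (word π)) (perms n) ≡ motzkin n)
    × ((k : ℕ) →
        count (λ π → good (word π) ∧ (des (word π) ≡ᵇ k)) (perms n)
          ≡ (n C (2 * k)) * catalan k)
corollary4p6 n = all-descents , by-descents
  where
  open ≡-Reasoning
  all-descents : count (λ π → good (word π)) (perms n) ≡ motzkin n
  all-descents = begin
    count (λ π → good (word π)) (perms n)
      ≡⟨ count-by-level (suc n) _ (des ∘ word) (perms n) (λ π _ → s≤s (des-word≤ π)) ⟩
    ∑ (suc n) (λ k → count (λ π → good (word π) ∧ (des (word π) ≡ᵇ k)) (perms n))
      ≡⟨ ∑-cong (suc n) (count-good-with-descents n) ⟩
    motzkinRow n
      ≡⟨ sym (motzkin≡motzkinRow n) ⟩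
    motzkin n ∎
  by-descents : (k : ℕ) → count (λ π → good (word π) ∧ (des (word π) ≡ᵇ k)) (perms n) ≡ (n C (2 * k)) * catalan k
  by-descents k = trans (count-good-with-descents n k) (motzkinTri≡C*catalan n k)
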